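{- Let $q$ be a prime power, $t$ a positive integer, $n=2t$, $\xi\in\mathbb{F}_{q^n}\setminus\mathbb{F}_{q^t}$ and $f\in\mathcal{L}_{t,q}$. Suppose that $\langle(1,0)\rangle_{\mathbb{F}_{q^t}}\notin L_f$. Let $L=L_{\mathbb{F}_{q^t}\times S_{f,\xi}}\subseteq\mathrm{PG}(1,q^n)$. Then: (1) $L$ has rank $n$; (2) $w_L(\langle(1,0)\rangle_{\mathbb{F}_{q^n}})=w_L(\langle(0,1)\rangle_{\mathbb{F}_{q^n}})=t$; (3) for every $m\in\mathbb{F}_{q^n}^*$, writing $m=m_0+m_1\xi$ with $m_0,m_1\in\mathbb{F}_{q^t}$, we have $w_L(\langle(1,m)\rangle_{\mathbb{F}_{q^n}})=w_{L_f}(\langle(m_0,m_1)\rangle_{\mathbb{F}_{q^t}})$; (4) if $W_{L_f}(X)=\sum_{w=1}^tA_wX^w$, where $A_w$ is the number of points of weight $w$ in $L_f$, and $W_L$ is defined analogously for $L$, then $W_L(X)=2X^t+(q^t-1)W_{L_f}(X)$.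
   Context: $\mathcal{L}_{t,q}$ is the set of $\mathbb{F}_q$-linearised polynomials $\sum_{i=0}^{t-1}c_iX^{q^i}$, $c_i\in\mathbb{F}_{q^t}$, viewed as $\mathbb{F}_q$-linear maps of $\mathbb{F}_{q^t}$. For an $\mathbb{F}_q$-subspace $U$ of $\mathbb{F}_{q^N}^2$, $L_U=\{\langle u\rangle_{\mathbb{F}_{q^N}}: u\in U\setminus\{0\}\}\subseteq\mathrm{PG}(1,q^N)$, its rank is $\dim_{\mathbb{F}_q}U$, and the weight of a point $\langle v\rangle$ is $\dim_{\mathbb{F}_q}(U\cap\langle v\rangle_{\mathbb{F}_{q^N}})$ (weight 0 if the point is not in $L_U$). $L_f=L_{U_f}\subseteq\mathrm{PG}(1,q^t)$ with $U_f=\{(x,f(x)):x\in\mathbb{F}_{q^t}\}$, i.e. $L_f=\{\langle(x,f(x))\rangle_{\mathbb{F}_{q^t}}:x\in\mathbb{F}_{q^t}^*\}$. $S_{f,\xi}=\{u+\xi f(u):u\in\mathbb{F}_{q^t}\}$, and $\mathbb{F}_{q^t}\times S_{f,\xi}=\{(a,s):a\in\mathbb{F}_{q^t},s\in S_{f,\xi}\}$. -}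

module Defs where

open import Level using (0ℓ)
open import Data.Nat as ℕ using (ℕ; zero; suc; _≥_)
open import Data.Nat.Primality using (Prime)
open import Data.Fin using (Fin; zero; suc; toℕ)
open import Data.Unit using (⊤)
open import Data.Maybe using (Maybe; just; nothing)
open import Data.Product using (Σ; ∃; ∃-syntax; _×_; _,_)
open import Relation.Binary.PropositionalEquality using (_≡_; _≢_)
open import Relation.Nullary using (¬_)
open import Algebra.Structures using (IsCommutativeRing)

IsPrimePower : ℕ → Set
IsPrimePower q = ∃[ p ] ∃[ k ] (Prime p × k ≥ 1 × q ≡ p ℕ.^ k)

record HasCard {A : Set} (P : A → Set) (n : ℕ) : Set where
  field
    enum     : Fin n → A
    enum-P   : ∀ i → P (enum i)
    enum-inj : ∀ i j → enum i ≡ enum j → i ≡ j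
    enum-sur : ∀ a → P a → ∃[ i ] (enum i ≡ a)

record Field : Set₁ where
  infixl 7 _*_
  infixl 6 _+_
  field
    Carrier : Set
    _+_ _*_ : Carrier → Carrier → Carrier
    -_      : Carrier → Carrier
    0# 1#   : Carrier
    isCommutativeRing : IsCommutativeRing _≡_ _+_ _*_ -_ 0# 1#
    0≢1     : 0# ≢ 1#
    inverse : ∀ x → x ≢ 0# → ∃[ y ] (x * y ≡ 1#)

module FieldDefs (K : Field) where
  open Field K public

  infixr 8 _^_
  _^_ : Carrier → ℕ → Carrier
  x ^ zero  = 1#
  x ^ suc n = x * (x ^ n)

  sumFin : ∀ t → (Fin t → Carrier) → Carrier
  sumFin zero    g = 0#
  sumFin (suc t) g = g zero + sumFin t (λ i → g (suc i))

  -- The subfield F_{q^k} of K: the fixed points of x ↦ x^(q^k)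
  Sub : ℕ → ℕ → Carrier → Set
  Sub q k x = x ^ (q ℕ.^ k) ≡ x

  V2 : Set
  V2 = Carrier × Carrier

  0v : V2
  0v = 0# , 0#

  _+v_ : V2 → V2 → V2
  (a , b) +v (c , d) = (a + c) , (b + d)

  _·_ : Carrier → V2 → V2
  λ' · (a , b) = (λ' * a) , (λ' * b)

  sumV : ∀ d → (Fin d → V2) → V2
  sumV zero    g = 0v
  sumV (suc d) g = g zero +v sumV d (λ i → g (suc i))

  span : (Carrier → Set) → V2 → V2 → Set
  span F v w = ∃[ c ] (F c × w ≡ c · v)

  record HasDim (F : Carrier → Set) (U : V2 → Set) (d : ℕ) : Set where
    field
      basis   : Fin d → V2
      closed  : (c : Fin d → Carrier) → (∀ i → F (c i)) →
                U (sumV d (λ i → c i · basis i))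
      spans   : ∀ u → U u → Σ (Fin d → Carrier) λ c → ((∀ i → F (c i)) ×
                  u ≡ sumV d (λ i → c i · basis i))
      indep   : (c e : Fin d → Carrier) → (∀ i → F (c i)) → (∀ i → F (e i)) →
                sumV d (λ i → c i · basis i) ≡ sumV d (λ i → e i · basis i) →
                ∀ i → c i ≡ e i

  -- the point ⟨v⟩_E of PG(1,E) (E a subfield) belongs to L_U
  InL : (E : Carrier → Set) → (V2 → Set) → V2 → Set
  InL E U v = ∃[ u ] (U u × u ≢ 0v × span E v u)

  -- weight of ⟨v⟩_E in L_U, measured over F_q (predicate Fq):
  -- dim_{F_q} (U ∩ ⟨v⟩_E) = w
  Weight : (Fq E : Carrier → Set) → (V2 → Set) → V2 → ℕ → Set
  Weight Fq E U v w = HasDim Fq (λ u → U u × span E v u) w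

  -- canonical representatives of points of PG(1,E):
  -- nothing ↦ ⟨(0,1)⟩, just m ↦ ⟨(1,m)⟩  (m ∈ E)
  ptVec : Maybe Carrier → V2
  ptVec nothing  = 0# , 1#
  ptVec (just m) = 1# , m

  IsPoint : (E : Carrier → Set) → Maybe Carrier → Set
  IsPoint E nothing  = ⊤
  IsPoint E (just m) = E m

  -- the whole field K = F_{q^n}
  All : Carrier → Set
  All _ = ⊤

  -- f ∈ L_{t,q} with coefficients c i ∈ F_{q^t}:  f(x) = Σ_{i<t} c_i x^(q^i)
  linPoly : (q t : ℕ) → (Fin t → Carrier) → Carrier → Carrier
  linPoly q t c x = sumFin t (λ i → c i * x ^ (q ℕ.^ toℕ i))

  Uf : (q t : ℕ) → (Carrier → Carrier) → V2 → Set
  Uf q t f u = ∃[ x ] (Sub q t x × u ≡ (x , f x))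

  Sfξ : (q t : ℕ) → (Carrier → Carrier) → Carrier → Carrier → Set
  Sfξ q t f ξ s = ∃[ u ] (Sub q t u × s ≡ u + ξ * f u)

  UL : (q t : ℕ) → (Carrier → Carrier) → Carrier → V2 → Set
  UL q t f ξ (a , s) = Sub q t a × Sfξ q t f ξ s

{-# OPTIONS --safe #-}
-- Since 1, ξ is an F_{q^t}-basis of F_{q^n}, the map (a, b) ↦ (m₀ a, m₁ a) carries U ∩ ⟨(1, m₀ + m₁ ξ)⟩
-- bijectively onto U_f ∩ ⟨(m₀, m₁)⟩_{F_{q^t}}, where U = F_{q^t} × S_{f,ξ}; the points ⟨(1,0)⟩ and ⟨(0,1)⟩
-- meet U in F_{q^t} × {0} and {0} × S_{f,ξ}, and u ↦ u + ξ f(u) is injective on F_{q^t}.  Weights are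
-- read off from cardinalities, since an F_q-subspace with q ^ w elements has dimension w.  Each point
-- ⟨(1, μ)⟩ of L_f comes from the q ^ t - 1 points ⟨(1, α + αμ ξ)⟩, α ∈ F_{q^t}^*, of L, and ⟨(0,1)⟩ ∉ L_f.
-- Underneath lie |F_{q^k}| = q ^ k for k ∣ n and the additivity of x ↦ x ^ p in characteristic p.

module Submission where

open import Level using (0ℓ)
open import Defs
open import Algebra.Bundles using (CommutativeRing; CommutativeMonoid; CommutativeSemiring)
open import Algebra.Structures using (IsCommutativeMonoid; IsCommutativeRing)
import Algebra.Properties.AbelianGroup as AbelianGroupProperties
import Algebra.Properties.CommutativeMonoid.Sum as SumProperties
import Algebra.Properties.CommutativeSemigroup as CommutativeSemigroupProperties
import Algebra.Properties.CommutativeSemiring.Binomial as BinomialProperties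
import Algebra.Properties.Group as GroupProperties
import Algebra.Properties.Ring as RingProperties
import Algebra.Properties.Semiring.Exp as ExpProperties
import Algebra.Properties.Semiring.Mult as MultProperties
open import Data.Bool using (true; false; if_then_else_; T)
open import Data.Empty using (⊥; ⊥-elim)
open import Data.Fin as Fin using (Fin; zero; suc; toℕ)
import Data.Fin.Properties as Fin
open import Data.Fin.Permutation using (Permutation; permutation)
open import Data.Maybe using (Maybe; just; nothing)
open import Data.Maybe.Properties using (just-injective)
open import Data.Nat as ℕ using (ℕ; zero; suc; _∸_; _≥_; _≡ᵇ_; s≤s; z≤n; _!; nonTrivial⇒n>1)
import Data.Nat.Properties as ℕ
open import Data.Nat.Combinatorics using (_C_; nCk≡n!/k![n-k]!; k![n∸k]!∣n!; nCn≡1)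
open import Data.Nat.Divisibility using (_∣_; divides; ∣1⇒≡1; ∣⇒≤; m∣m*n)
open import Data.Nat.DivMod using (_/_; m*[n/m]≡n)
open import Data.Nat.Primality using (Prime; ¬prime[0]; ¬prime[1]; euclidsLemma; prime⇒nonTrivial)
open import Data.Product using (∃; ∃-syntax; _×_; _,_; proj₁; proj₂)
open import Data.Product.Properties using () renaming (≡-dec to ×-≡-dec)
open import Data.Sum using (_⊎_; inj₁; inj₂)
open import Data.Unit using (tt)
open import Function using (id)
open import Function.Bundles using (_⇔_; mk⇔; Injection; Equivalence)
open import Function.Properties.Inverse using (↔⇒↣)
open import Relation.Binary.Definitions using (DecidableEquality; tri<; tri≈; tri>)
open import Relation.Binary.PropositionalEquality
  using (_≡_; _≢_; refl; sym; trans; cong; cong₂; subst; module ≡-Reasoning)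
open import Relation.Nullary using (¬_; Dec; yes; no)
open import Relation.Nullary.Decidable using (¬?; _×-dec_; map′; decidable-stable)
open import Relation.Unary using (Pred; Decidable; _⊆_; _∩_; _∪_; _∖_; ∅; ｛_｝; _⟨×⟩_)

-- Counting

record InjectionOn {A B : Set} (P : Pred A 0ℓ) (Q : Pred B 0ℓ) (f : A → B) : Set where
  field
    maps-to   : ∀ {x} → P x → Q (f x)
    injective : ∀ {x y} → P x → P y → f x ≡ f y → x ≡ y

record BijectionOn {A B : Set} (P : Pred A 0ℓ) (Q : Pred B 0ℓ) (f : A → B) : Set where
  field
    injection  : InjectionOn P Q f
    surjective : ∀ {y} → Q y → ∃[ x ] (P x × f x ≡ y)
  open InjectionOn injection public

identityOn : {A : Set} {P Q : Pred A 0ℓ} → P ⊆ Q → InjectionOn P Q (λ x → x)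
identityOn P⊆Q = record { maps-to = P⊆Q ; injective = λ _ _ eq → eq }

module _ {A : Set} {P : Pred A 0ℓ} {n : ℕ} (card : HasCard P n) where
  open HasCard card

  index : ∀ {x} → P x → Fin n
  index {x} px = proj₁ (enum-sur x px)

  enum-index : ∀ {x} (px : P x) → enum (index px) ≡ x
  enum-index {x} px = proj₂ (enum-sur x px)

  index-enum : ∀ i → index (enum-P i) ≡ i
  index-enum i = enum-inj _ _ (enum-index (enum-P i))

  index-injective : ∀ {x y} (px : P x) (py : P y) → index px ≡ index py → x ≡ y
  index-injective px py eq = trans (sym (enum-index px)) (trans (cong enum eq) (enum-index py))

  HasCard⇒decidable : DecidableEquality A → Decidable P
  HasCard⇒decidable _≟_ x with Fin.any? (λ i → enum i ≟ x)
  ... | yes (i , refl) = yes (enum-P i)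
  ... | no  ∄i         = no (λ px → ∄i (index px , enum-index px))

module _ {A B : Set} {P : Pred A 0ℓ} {Q : Pred B 0ℓ} {f : A → B} where

  HasCard-injection⇒≤ : ∀ {a b} → HasCard P a → HasCard Q b → InjectionOn P Q f → a ℕ.≤ b
  HasCard-injection⇒≤ cardP cardQ inj = Fin.injective⇒≤ {f = g} g-injective
    where
    open InjectionOn inj
    module P = HasCard cardP
    g : _ → _
    g i = index cardQ (maps-to (P.enum-P i))
    g-injective : ∀ {i j} → g i ≡ g j → i ≡ j
    g-injective {i} {j} eq = P.enum-inj i j (injective (P.enum-P i) (P.enum-P j) (begin
      f (P.enum i)                                  ≡⟨ enum-index cardQ _ ⟨
      HasCard.enum cardQ (g i)                      ≡⟨ cong (HasCard.enum cardQ) eq ⟩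
      HasCard.enum cardQ (g j)                      ≡⟨ enum-index cardQ _ ⟩
      f (P.enum j)                                  ∎))
      where open ≡-Reasoning

  HasCard-image : ∀ {n} → HasCard P n → BijectionOn P Q f → HasCard Q n
  HasCard-image cardP bij = record
    { enum     = λ i → f (P.enum i)
    ; enum-P   = λ i → maps-to (P.enum-P i)
    ; enum-inj = λ i j eq → P.enum-inj i j (injective (P.enum-P i) (P.enum-P j) eq)
    ; enum-sur = λ y qy → let x , px , fx≡y = surjective qy in
                          index cardP px , trans (cong f (enum-index cardP px)) fx≡y
    }
    where
    open BijectionOn bij
    module P = HasCard cardP

  HasCard-preimage : ∀ {n} → HasCard Q n → BijectionOn P Q f → HasCard P n
  HasCard-preimage cardQ bij = record
    { enum     = λ i → proj₁ (pre i)
    ; enum-P   = λ i → proj₁ (proj₂ (pre i))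
    ; enum-inj = λ i j eq → Q.enum-inj i j (begin
        Q.enum i         ≡⟨ proj₂ (proj₂ (pre i)) ⟨
        f (proj₁ (pre i)) ≡⟨ cong f eq ⟩
        f (proj₁ (pre j)) ≡⟨ proj₂ (proj₂ (pre j)) ⟩
        Q.enum j         ∎)
    ; enum-sur = λ x px → let i = index cardQ (maps-to px) in
        i , injective (proj₁ (proj₂ (pre i))) px (trans (proj₂ (proj₂ (pre i))) (enum-index cardQ _))
    }
    where
    open BijectionOn bij
    open ≡-Reasoning
    module Q = HasCard cardQ
    pre : ∀ i → ∃[ x ] (P x × f x ≡ Q.enum i)
    pre i = surjective (Q.enum-P i)

module _ {A : Set} {P Q : Pred A 0ℓ} where

  HasCard-⊆⇒≤ : ∀ {a b} → HasCard P a → HasCard Q b → P ⊆ Q → a ℕ.≤ b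
  HasCard-⊆⇒≤ cardP cardQ P⊆Q = HasCard-injection⇒≤ cardP cardQ (identityOn P⊆Q)

  HasCard-resp-⇔ : ∀ {n} → HasCard P n → P ⊆ Q → Q ⊆ P → HasCard Q n
  HasCard-resp-⇔ cardP P⊆Q Q⊆P =
    HasCard-image cardP record { injection = identityOn P⊆Q ; surjective = λ qy → _ , Q⊆P qy , refl }

  HasCard-∪ : ∀ {a b} → HasCard P a → HasCard Q b → (∀ {x} → P x → Q x → ⊥) →
              HasCard (P ∪ Q) (a ℕ.+ b)
  HasCard-∪ {a} {b} cardP cardQ disjoint = record
    { enum = enum ; enum-P = enum-P ; enum-inj = enum-inj ; enum-sur = enum-sur }
    where
    module P = HasCard cardP
    module Q = HasCard cardQ
    enum⊎ : Fin a ⊎ Fin b → A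
    enum⊎ (inj₁ i) = P.enum i
    enum⊎ (inj₂ j) = Q.enum j
    enum : Fin (a ℕ.+ b) → A
    enum k = enum⊎ (Fin.splitAt a k)
    enum-P : ∀ k → (P ∪ Q) (enum k)
    enum-P k with Fin.splitAt a k
    ... | inj₁ i = inj₁ (P.enum-P i)
    ... | inj₂ j = inj₂ (Q.enum-P j)
    enum⊎-inj : ∀ s s' → enum⊎ s ≡ enum⊎ s' → s ≡ s'
    enum⊎-inj (inj₁ i) (inj₁ i') eq = cong inj₁ (P.enum-inj i i' eq)
    enum⊎-inj (inj₂ j) (inj₂ j') eq = cong inj₂ (Q.enum-inj j j' eq)
    enum⊎-inj (inj₁ i) (inj₂ j') eq = ⊥-elim (disjoint (P.enum-P i) (subst Q (sym eq) (Q.enum-P j')))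
    enum⊎-inj (inj₂ j) (inj₁ i') eq = ⊥-elim (disjoint (P.enum-P i') (subst Q eq (Q.enum-P j)))
    enum-inj : ∀ k k' → enum k ≡ enum k' → k ≡ k'
    enum-inj k k' eq = Injection.injective (↔⇒↣ Fin.+↔⊎) (enum⊎-inj _ _ eq)
    enum-sur : ∀ x → (P ∪ Q) x → ∃[ k ] (enum k ≡ x)
    enum-sur x (inj₁ px) = index cardP px Fin.↑ˡ b ,
      trans (cong enum⊎ (Fin.splitAt-↑ˡ a (index cardP px) b)) (enum-index cardP px)
    enum-sur x (inj₂ qx) = a Fin.↑ʳ index cardQ qx ,
      trans (cong enum⊎ (Fin.splitAt-↑ʳ a b (index cardQ qx))) (enum-index cardQ qx)

module _ {A B : Set} {P : Pred A 0ℓ} {Q : Pred B 0ℓ} where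

  HasCard-⟨×⟩ : ∀ {a b} → HasCard P a → HasCard Q b → HasCard (P ⟨×⟩ Q) (a ℕ.* b)
  HasCard-⟨×⟩ {a} {b} cardP cardQ = record
    { enum     = enum
    ; enum-P   = λ k → P.enum-P _ , Q.enum-P _
    ; enum-inj = λ k k' eq → Injection.injective (↔⇒↣ (Fin.*↔× {a} {b}))
                   (cong₂ _,_ (P.enum-inj _ _ (cong proj₁ eq)) (Q.enum-inj _ _ (cong proj₂ eq)))
    ; enum-sur = λ (x , y) (px , qy) → Fin.combine (index cardP px) (index cardQ qy) , (begin
        enum (Fin.combine (index cardP px) (index cardQ qy))
          ≡⟨ cong (λ (i , j) → P.enum i , Q.enum j) (Fin.remQuot-combine (index cardP px) (index cardQ qy)) ⟩
        P.enum (index cardP px) , Q.enum (index cardQ qy)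
          ≡⟨ cong₂ _,_ (enum-index cardP px) (enum-index cardQ qy) ⟩
        x , y ∎)
    }
    where
    open ≡-Reasoning
    module P = HasCard cardP
    module Q = HasCard cardQ
    enum : Fin (a ℕ.* b) → A × B
    enum k = let i , j = Fin.remQuot {a} b k in P.enum i , Q.enum j

module _ {A : Set} where

  HasCard-｛｝ : (x : A) → HasCard ｛ x ｝ 1
  HasCard-｛｝ x = record
    { enum = λ _ → x ; enum-P = λ _ → refl
    ; enum-inj = λ { zero zero _ → refl } ; enum-sur = λ y x≡y → zero , x≡y }

  HasCard-∅ : HasCard {A} ∅ 0
  HasCard-∅ = record { enum = λ () ; enum-P = λ () ; enum-inj = λ () ; enum-sur = λ _ () }

  HasCard-unique : ∀ {P : Pred A 0ℓ} {a b} → HasCard P a → HasCard P b → a ≡ b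
  HasCard-unique cardP cardP' =
    ℕ.≤-antisym (HasCard-⊆⇒≤ cardP cardP' (λ p → p)) (HasCard-⊆⇒≤ cardP' cardP (λ p → p))

HasCard-Fin-decidable : ∀ {m} {P : Pred (Fin m) 0ℓ} → Decidable P → ∃[ n ] HasCard P n
HasCard-Fin-decidable {zero}  P? = 0 , record { enum = λ () ; enum-P = λ () ; enum-inj = λ () ; enum-sur = λ () }
HasCard-Fin-decidable {suc m} {P} P? with HasCard-Fin-decidable {m} (λ i → P? (suc i)) | P? zero
... | n , cardP∘suc | no ¬P0 = n , record
  { enum     = λ i → suc (Pₛ.enum i)
  ; enum-P   = Pₛ.enum-P
  ; enum-inj = λ i j eq → Pₛ.enum-inj i j (Fin.suc-injective eq)
  ; enum-sur = λ { zero P0 → ⊥-elim (¬P0 P0) ; (suc x) px → index cardP∘suc px , cong suc (enum-index cardP∘suc px) }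
  }
  where module Pₛ = HasCard cardP∘suc
... | n , cardP∘suc | yes P0 = suc n , record
  { enum = enum ; enum-P = enum-P ; enum-inj = enum-inj
  ; enum-sur = λ { zero _ → zero , refl ; (suc x) px → suc (index cardP∘suc px) , cong suc (enum-index cardP∘suc px) }
  }
  where
  module Pₛ = HasCard cardP∘suc
  enum : Fin (suc n) → Fin (suc m)
  enum zero    = zero
  enum (suc i) = suc (Pₛ.enum i)
  enum-P : ∀ i → P (enum i)
  enum-P zero    = P0
  enum-P (suc i) = Pₛ.enum-P i
  enum-inj : ∀ i j → enum i ≡ enum j → i ≡ j
  enum-inj zero    zero    _  = refl
  enum-inj (suc i) (suc j) eq = cong suc (Pₛ.enum-inj i j (Fin.suc-injective eq))

module _ {A : Set} {Q : Pred A 0ℓ} {m : ℕ} (cardQ : HasCard Q m) where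
  private module Q = HasCard cardQ

  HasCard-∩-decidable : {P : Pred A 0ℓ} → Decidable P → ∃[ n ] HasCard (Q ∩ P) n
  HasCard-∩-decidable {P} P? = let n , cardP∘enum = HasCard-Fin-decidable (λ i → P? (Q.enum i)) in
    n , HasCard-image cardP∘enum record
      { injection  = record { maps-to = λ {i} p → Q.enum-P i , p ; injective = λ _ _ → Q.enum-inj _ _ }
      ; surjective = λ (qy , py) → index cardQ qy , subst P (sym (enum-index cardQ qy)) py , enum-index cardQ qy
      }

  HasCard-remove : DecidableEquality A → ∀ {x} → Q x → HasCard (Q ∖ ｛ x ｝) (m ∸ 1)
  HasCard-remove _≟_ {x} qx = subst (HasCard (Q ∖ ｛ x ｝)) m≡n+1 cardQ∖x
    where
    rest = HasCard-∩-decidable (λ y → ¬? (x ≟ y))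
    n = proj₁ rest
    cardQ∖x : HasCard (Q ∖ ｛ x ｝) n
    cardQ∖x = proj₂ rest
    split : ∀ {y} → Q y → (Q ∖ ｛ x ｝) y ⊎ ｛ x ｝ y
    split {y} qy with x ≟ y
    ... | yes x≡y = inj₂ x≡y
    ... | no x≢y  = inj₁ (qy , x≢y)
    m≡n+1 : n ≡ m ∸ 1
    m≡n+1 = sym (trans (cong (_∸ 1) (HasCard-unique cardQ (HasCard-resp-⇔
      (HasCard-∪ cardQ∖x (HasCard-｛｝ x) (λ (_ , x≢y) x≡y → x≢y x≡y))
      (λ { (inj₁ (qy , _)) → qy ; (inj₂ refl) → qx }) split))) (ℕ.m+n∸n≡m n 1))

  HasCard-⊆⇒⊇ : ∀ {P : Pred A 0ℓ} → DecidableEquality A → Decidable P →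
                HasCard P m → P ⊆ Q → Q ⊆ P
  HasCard-⊆⇒⊇ {P} _≟_ P? cardP P⊆Q {x} qx with P? x
  ... | yes px = px
  ... | no ¬px = ⊥-elim (ℕ.<⇒≱ (m∸1<m (index cardQ qx))
                   (HasCard-⊆⇒≤ cardP (HasCard-remove _≟_ qx) (λ {y} py → P⊆Q py , λ { refl → ¬px py })))
    where
    m∸1<m : ∀ {m} → Fin m → m ∸ 1 ℕ.< m
    m∸1<m {suc m} _ = ℕ.≤-refl

1+m≤n*m : ∀ {m n} → 1 ℕ.< n → m ≥ 1 → 1 ℕ.+ m ℕ.≤ n ℕ.* m
1+m≤n*m {m} {n} 1<n m≥1 = begin
  1 ℕ.+ m        ≤⟨ ℕ.+-monoˡ-≤ m m≥1 ⟩
  m ℕ.+ m        ≡⟨ cong (m ℕ.+_) (ℕ.+-identityʳ m) ⟨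
  2 ℕ.* m        ≤⟨ ℕ.*-monoˡ-≤ m 1<n ⟩
  n ℕ.* m        ∎
  where open ℕ.≤-Reasoning

p∤m! : ∀ {p} → Prime p → ∀ {m} → m ℕ.< p → ¬ p ∣ m !
p∤m! p-prime {zero}  _   p∣1  = ¬prime[1] (subst Prime (∣1⇒≡1 p∣1) p-prime)
p∤m! p-prime {suc m} m<p p∣m! with euclidsLemma (suc m) (m !) p-prime p∣m!
... | inj₁ p∣1+m = ℕ.<⇒≱ m<p (∣⇒≤ p∣1+m)
... | inj₂ p∣m!  = p∤m! p-prime (ℕ.<-trans (ℕ.n<1+n m) m<p) p∣m!

p∣pCk : ∀ {p k} → Prime p → 0 ℕ.< k → k ℕ.< p → p ∣ p C k
p∣pCk {zero}  p-prime = ⊥-elim (¬prime[0] p-prime)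
p∣pCk {suc p} {k} p-prime 0<k k<p with euclidsLemma (suc p C k) (k ! ℕ.* (suc p ∸ k) !) p-prime p∣pCk*d
  where
  k≤p = ℕ.<⇒≤ k<p
  d = k ! ℕ.* (suc p ∸ k) !
  instance
    _ = k ℕ.!* (suc p ∸ k) !≢0
  p∣pCk*d : suc p ∣ (suc p C k) ℕ.* d
  p∣pCk*d = subst (suc p ∣_) (sym (begin
    (suc p C k) ℕ.* d          ≡⟨ cong (ℕ._* d) (nCk≡n!/k![n-k]! k≤p) ⟩
    (suc p ! / d) ℕ.* d        ≡⟨ ℕ.*-comm (suc p ! / d) d ⟩
    d ℕ.* (suc p ! / d)        ≡⟨ m*[n/m]≡n (k![n∸k]!∣n! k≤p) ⟩
    suc p !                    ∎)) (m∣m*n (p !))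
    where open ≡-Reasoning
... | inj₁ p∣pCk = p∣pCk
... | inj₂ p∣k!*[p-k]! with euclidsLemma (k !) ((suc p ∸ k) !) p-prime p∣k!*[p-k]!
...   | inj₁ p∣k!     = ⊥-elim (p∤m! p-prime k<p p∣k!)
...   | inj₂ p∣[p-k]! = ⊥-elim (p∤m! p-prime (ℕ.∸-monoʳ-< 0<k (ℕ.<⇒≤ k<p)) p∣[p-k]!)

module FieldProperties (K : Field) where
  open FieldDefs K
  open ≡-Reasoning

  commutativeRing : CommutativeRing 0ℓ 0ℓ
  commutativeRing = record { isCommutativeRing = isCommutativeRing }

  open CommutativeRing commutativeRing public
    using ( +-assoc; +-comm; +-identityˡ; +-identityʳ; -‿inverseˡ; -‿inverseʳ
          ; *-assoc; *-comm; *-identityˡ; *-identityʳ; distribˡ; distribʳ; zeroˡ; zeroʳ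
          ; semiring; commutativeSemiring)
  open RingProperties (CommutativeRing.ring commutativeRing) public
    using (-1*x≈-x; -‿distribˡ-*; -‿distribʳ-*)
  open GroupProperties (CommutativeRing.+-group commutativeRing) public
    using (inverseˡ-unique; inverseʳ-unique; x∙y⁻¹≈ε⇒x≈y; //-rightDividesˡ; //-rightDividesʳ)
    renaming (∙-cancelˡ to +-cancelˡ; ∙-cancelʳ to +-cancelʳ)
  open AbelianGroupProperties (CommutativeRing.+-abelianGroup commutativeRing) public
    using (⁻¹-∙-comm)
  open CommutativeSemigroupProperties (CommutativeRing.+-commutativeSemigroup commutativeRing) public
    using () renaming (interchange to +-interchange)
  open CommutativeSemigroupProperties (CommutativeRing.*-commutativeSemigroup commutativeRing) public
    using (x∙yz≈y∙xz) renaming (interchange to *-interchange)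

  infixl 6 _-_
  _-_ : Carrier → Carrier → Carrier
  x - y = x + - y

  [x-y]+[y-z]≡x-z : ∀ x y z → (x - y) + (y - z) ≡ x - z
  [x-y]+[y-z]≡x-z x y z = begin
    (x + - y) + (y + - z)   ≡⟨ +-assoc x (- y) _ ⟩
    x + (- y + (y + - z))   ≡⟨ cong (x +_) (+-assoc (- y) y (- z)) ⟨
    x + ((- y + y) + - z)   ≡⟨ cong (λ w → x + (w + - z)) (-‿inverseˡ y) ⟩
    x + (0# + - z)          ≡⟨ cong (x +_) (+-identityˡ _) ⟩
    x - z                   ∎

  1≢0 : 1# ≢ 0#
  1≢0 eq = 0≢1 (sym eq)

  x*y≡0⇒y≡0 : ∀ {x y} → x ≢ 0# → x * y ≡ 0# → y ≡ 0#
  x*y≡0⇒y≡0 {x} {y} x≢0 xy≡0 = let x⁻¹ , xx⁻¹≡1 = inverse x x≢0 in begin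
    y              ≡⟨ *-identityˡ y ⟨
    1# * y         ≡⟨ cong (_* y) xx⁻¹≡1 ⟨
    (x * x⁻¹) * y  ≡⟨ cong (_* y) (*-comm x x⁻¹) ⟩
    (x⁻¹ * x) * y  ≡⟨ *-assoc x⁻¹ x y ⟩
    x⁻¹ * (x * y)  ≡⟨ cong (x⁻¹ *_) xy≡0 ⟩
    x⁻¹ * 0#       ≡⟨ zeroʳ x⁻¹ ⟩
    0#             ∎

  *-nonzero : ∀ {x y} → x ≢ 0# → y ≢ 0# → x * y ≢ 0#
  *-nonzero x≢0 y≢0 xy≡0 = y≢0 (x*y≡0⇒y≡0 x≢0 xy≡0)

  *-cancelˡ : ∀ {x y z} → x ≢ 0# → x * y ≡ x * z → y ≡ z
  *-cancelˡ {x} {y} {z} x≢0 xy≡xz = x∙y⁻¹≈ε⇒x≈y y z (x*y≡0⇒y≡0 x≢0 (begin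
    x * (y - z)          ≡⟨ distribˡ x y (- z) ⟩
    x * y + x * - z      ≡⟨ cong (x * y +_) (-‿distribʳ-* x z) ⟨
    x * y - x * z        ≡⟨ cong (_- x * z) xy≡xz ⟩
    x * z - x * z        ≡⟨ -‿inverseʳ (x * z) ⟩
    0#                   ∎))

  ^-distribˡ-+-* : ∀ x m n → x ^ (m ℕ.+ n) ≡ x ^ m * x ^ n
  ^-distribˡ-+-* x zero    n = sym (*-identityˡ _)
  ^-distribˡ-+-* x (suc m) n = trans (cong (x *_) (^-distribˡ-+-* x m n)) (sym (*-assoc x _ _))

  ^-*-assoc : ∀ x m n → (x ^ m) ^ n ≡ x ^ (m ℕ.* n)
  ^-*-assoc x m zero    = cong (x ^_) (sym (ℕ.*-zeroʳ m))
  ^-*-assoc x m (suc n) = begin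
    x ^ m * (x ^ m) ^ n      ≡⟨ cong (x ^ m *_) (^-*-assoc x m n) ⟩
    x ^ m * x ^ (m ℕ.* n)    ≡⟨ ^-distribˡ-+-* x m (m ℕ.* n) ⟨
    x ^ (m ℕ.+ m ℕ.* n)      ≡⟨ cong (x ^_) (ℕ.*-suc m n) ⟨
    x ^ (m ℕ.* suc n)        ∎

  ^-distribʳ-* : ∀ x y n → (x * y) ^ n ≡ x ^ n * y ^ n
  ^-distribʳ-* x y zero    = sym (*-identityˡ 1#)
  ^-distribʳ-* x y (suc n) = trans (cong (x * y *_) (^-distribʳ-* x y n)) (*-interchange x y _ _)

  1^n≡1 : ∀ n → 1# ^ n ≡ 1#
  1^n≡1 zero    = refl
  1^n≡1 (suc n) = trans (*-identityˡ _) (1^n≡1 n)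

  0^n≡0 : ∀ {n} → n ≥ 1 → 0# ^ n ≡ 0#
  0^n≡0 {suc n} _ = zeroˡ _

  ^-nonzero : ∀ {x} n → x ≢ 0# → x ^ n ≢ 0#
  ^-nonzero zero    _   = 1≢0
  ^-nonzero (suc n) x≢0 = *-nonzero x≢0 (^-nonzero n x≢0)

  sumFin-cong : ∀ n {g h : Fin n → Carrier} → (∀ i → g i ≡ h i) → sumFin n g ≡ sumFin n h
  sumFin-cong zero    g≡h = refl
  sumFin-cong (suc n) g≡h = cong₂ _+_ (g≡h zero) (sumFin-cong n (λ i → g≡h (suc i)))

  sumFin-+ : ∀ n (g h : Fin n → Carrier) → sumFin n (λ i → g i + h i) ≡ sumFin n g + sumFin n h
  sumFin-+ zero    g h = sym (+-identityˡ 0#)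
  sumFin-+ (suc n) g h = trans (cong (g zero + h zero +_) (sumFin-+ n (λ i → g (suc i)) (λ i → h (suc i))))
                               (+-interchange _ _ _ _)

  sumFin-* : ∀ n a (g : Fin n → Carrier) → sumFin n (λ i → a * g i) ≡ a * sumFin n g
  sumFin-* zero    a g = sym (zeroʳ a)
  sumFin-* (suc n) a g = trans (cong (a * g zero +_) (sumFin-* n a (λ i → g (suc i)))) (sym (distribˡ a _ _))

  open MultProperties semiring public using () renaming (_×_ to _×ₙ_)

  -- The standard library's exponentiation, in which its binomial theorem is stated.
  _^′_ : Carrier → ℕ → Carrier
  _^′_ = ExpProperties._^_ semiring

  ^≡^′ : ∀ x n → x ^ n ≡ x ^′ n
  ^≡^′ x zero    = refl
  ^≡^′ x (suc n) = cong (x *_) (^≡^′ x n)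

module VectorProperties (K : Field) where
  open FieldDefs K
  open FieldProperties K

  infixl 6 _-v_
  _-v_ : V2 → V2 → V2
  u -v v = u +v ((- 1#) · v)

  +v-identityˡ : ∀ u → 0v +v u ≡ u
  +v-identityˡ (a , b) = cong₂ _,_ (+-identityˡ a) (+-identityˡ b)

  +v-interchange : ∀ u v w z → (u +v v) +v (w +v z) ≡ (u +v w) +v (v +v z)
  +v-interchange (a₁ , a₂) (b₁ , b₂) (c₁ , c₂) (d₁ , d₂) =
    cong₂ _,_ (+-interchange a₁ b₁ c₁ d₁) (+-interchange a₂ b₂ c₂ d₂)

  ·-distribˡ : ∀ c u v → c · (u +v v) ≡ (c · u) +v (c · v)
  ·-distribˡ c (a , b) (a′ , b′) = cong₂ _,_ (distribˡ c a a′) (distribˡ c b b′)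

  ·-distribʳ : ∀ c d u → (c + d) · u ≡ (c · u) +v (d · u)
  ·-distribʳ c d (a , b) = cong₂ _,_ (distribʳ a c d) (distribʳ b c d)

  ·-assoc : ∀ c d u → c · (d · u) ≡ (c * d) · u
  ·-assoc c d (a , b) = cong₂ _,_ (sym (*-assoc c d a)) (sym (*-assoc c d b))

  0·u≡0 : ∀ u → 0# · u ≡ 0v
  0·u≡0 (a , b) = cong₂ _,_ (zeroˡ a) (zeroˡ b)

  1·u≡u : ∀ u → 1# · u ≡ u
  1·u≡u (a , b) = cong₂ _,_ (*-identityˡ a) (*-identityˡ b)

  c·0≡0 : ∀ c → c · 0v ≡ 0v
  c·0≡0 c = cong₂ _,_ (zeroʳ c) (zeroʳ c)

  u-u≡0 : ∀ u → u -v u ≡ 0v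
  u-u≡0 (a , b) = cong₂ _,_ (x-x≡0 a) (x-x≡0 b)
    where
    x-x≡0 : ∀ x → x + (- 1#) * x ≡ 0#
    x-x≡0 x = trans (cong (x +_) (-1*x≈-x x)) (-‿inverseʳ x)

  [u+v]-u≡v : ∀ u v → (u +v v) -v u ≡ v
  [u+v]-u≡v (a , b) (c , d) = cong₂ _,_ (lemma a c) (lemma b d)
    where
    lemma : ∀ x y → (x + y) + (- 1#) * x ≡ y
    lemma x y = trans (cong ((x + y) +_) (-1*x≈-x x)) (trans (cong (_- x) (+-comm x y)) (//-rightDividesʳ x y))

  u+[v-u]≡v : ∀ u v → u +v (v -v u) ≡ v
  u+[v-u]≡v (a , b) (c , d) = cong₂ _,_ (lemma a c) (lemma b d)
    where
    lemma : ∀ x y → x + (y + (- 1#) * x) ≡ y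
    lemma x y = trans (cong (λ z → x + (y + z)) (-1*x≈-x x)) (trans (+-comm x _) (//-rightDividesˡ x y))

  u+v≡0⇒u≡-v : ∀ u v → u +v v ≡ 0v → u ≡ (- 1#) · v
  u+v≡0⇒u≡-v (a , b) (c , d) eq = cong₂ _,_ (lemma (cong proj₁ eq)) (lemma (cong proj₂ eq))
    where
    lemma : ∀ {x y} → x + y ≡ 0# → x ≡ (- 1#) * y
    lemma {x} {y} x+y≡0 = trans (inverseˡ-unique x y x+y≡0) (sym (-1*x≈-x y))

-- Finite fields

module FiniteField (K : Field) {N : ℕ} (finite : HasCard (FieldDefs.All K) N) where
  open FieldDefs K
  open FieldProperties K
  open ≡-Reasoning
  private module Elements = HasCard finite

  infix 4 _≟_
  _≟_ : DecidableEquality Carrier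
  x ≟ y = map′ (index-injective finite tt tt) (cong (λ z → index finite {z} tt)) (index finite tt Fin.≟ index finite tt)

  ∃? : {P : Pred Carrier 0ℓ} → Decidable P → Dec (∃ P)
  ∃? {P} P? with Fin.any? (λ i → P? (Elements.enum i))
  ... | yes (i , p) = yes (Elements.enum i , p)
  ... | no ∄i       = no (λ (x , px) → ∄i (index finite tt , subst P (sym (enum-index finite tt)) px))

  -- 0⁻¹ = 0 is a junk value.
  infix 8 _⁻¹
  _⁻¹ : Carrier → Carrier
  x ⁻¹ with x ≟ 0#
  ... | yes _   = 0#
  ... | no  x≢0 = proj₁ (inverse x x≢0)

  0⁻¹≡0 : 0# ⁻¹ ≡ 0#
  0⁻¹≡0 with 0# ≟ 0#
  ... | yes _   = refl
  ... | no  0≢0 = ⊥-elim (0≢0 refl)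

  x*x⁻¹≡1 : ∀ {x} → x ≢ 0# → x * x ⁻¹ ≡ 1#
  x*x⁻¹≡1 {x} x≢0 with x ≟ 0#
  ... | yes x≡0 = ⊥-elim (x≢0 x≡0)
  ... | no  x≢0 = proj₂ (inverse x x≢0)

  x⁻¹*x≡1 : ∀ {x} → x ≢ 0# → x ⁻¹ * x ≡ 1#
  x⁻¹*x≡1 x≢0 = trans (*-comm _ _) (x*x⁻¹≡1 x≢0)

  x*[x⁻¹*y]≡y : ∀ {x} → x ≢ 0# → ∀ y → x * (x ⁻¹ * y) ≡ y
  x*[x⁻¹*y]≡y x≢0 y = trans (sym (*-assoc _ _ y)) (trans (cong (_* y) (x*x⁻¹≡1 x≢0)) (*-identityˡ y))

  x⁻¹*[x*y]≡y : ∀ {x} → x ≢ 0# → ∀ y → x ⁻¹ * (x * y) ≡ y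
  x⁻¹*[x*y]≡y x≢0 y = trans (sym (*-assoc _ _ y)) (trans (cong (_* y) (x⁻¹*x≡1 x≢0)) (*-identityˡ y))

  [y*x⁻¹]*x≡y : ∀ {x} → x ≢ 0# → ∀ y → (y * x ⁻¹) * x ≡ y
  [y*x⁻¹]*x≡y x≢0 y = trans (*-assoc y _ _) (trans (cong (y *_) (x⁻¹*x≡1 x≢0)) (*-identityʳ y))

  [y*x]*x⁻¹≡y : ∀ {x} → x ≢ 0# → ∀ y → (y * x) * x ⁻¹ ≡ y
  [y*x]*x⁻¹≡y x≢0 y = trans (*-assoc y _ _) (trans (cong (y *_) (x*x⁻¹≡1 x≢0)) (*-identityʳ y))

  record IsSubfield (F : Pred Carrier 0ℓ) : Set where
    field
      0∈        : F 0#
      1∈        : F 1#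
      +-closed  : ∀ {x y} → F x → F y → F (x + y)
      -‿closed  : ∀ {x} → F x → F (- x)
      *-closed  : ∀ {x y} → F x → F y → F (x * y)
      ⁻¹-closed : ∀ {x} → F x → F (x ⁻¹)

    −-closed : ∀ {x y} → F x → F y → F (x - y)
    −-closed x∈ y∈ = +-closed x∈ (-‿closed y∈)

    ^-closed : ∀ {x} → F x → ∀ n → F (x ^ n)
    ^-closed x∈ zero    = 1∈
    ^-closed x∈ (suc n) = *-closed x∈ (^-closed x∈ n)

    sumFin-closed : ∀ n {g : Fin n → Carrier} → (∀ i → F (g i)) → F (sumFin n g)
    sumFin-closed zero    g∈ = 0∈
    sumFin-closed (suc n) g∈ = +-closed (g∈ zero) (sumFin-closed n (λ i → g∈ (suc i)))

  module _ {_∙_ : Carrier → Carrier → Carrier} {ε : Carrier}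
           (isCommutativeMonoid : IsCommutativeMonoid _≡_ _∙_ ε) where
    private
      monoid : CommutativeMonoid 0ℓ 0ℓ
      monoid = record { isCommutativeMonoid = isCommutativeMonoid }
      open SumProperties monoid using (sum; sum-permute; sum-cong-≗)

    ⨁ : (Carrier → Carrier) → Carrier
    ⨁ g = sum (λ i → g (Elements.enum i))

    ⨁-reindex : ∀ g (σ σ⁻¹ : Carrier → Carrier) → (∀ x → σ (σ⁻¹ x) ≡ x) → (∀ x → σ⁻¹ (σ x) ≡ x) →
                ⨁ g ≡ ⨁ (λ x → g (σ x))
    ⨁-reindex g σ σ⁻¹ σσ⁻¹ σ⁻¹σ = trans (sum-permute (λ i → g (Elements.enum i)) π)
      (sum-cong-≗ {N} (λ i → cong g (enum-index finite {σ (Elements.enum i)} tt)))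
      where
      lift : (Carrier → Carrier) → Fin N → Fin N
      lift h i = index finite {h (Elements.enum i)} tt
      lift-inverse : ∀ h h⁻¹ → (∀ x → h (h⁻¹ x) ≡ x) → ∀ i → lift h (lift h⁻¹ i) ≡ i
      lift-inverse h h⁻¹ hh⁻¹ i = begin
        index finite tt ≡⟨ cong (λ x → index finite {h x} tt) (enum-index finite tt) ⟩
        index finite {h (h⁻¹ (Elements.enum i))} tt ≡⟨ cong (λ x → index finite {x} tt) (hh⁻¹ _) ⟩
        index finite {Elements.enum i} tt ≡⟨ index-enum finite i ⟩
        i ∎
      π : Permutation N N
      π = permutation (lift σ) (lift σ⁻¹) (lift-inverse σ σ⁻¹ σσ⁻¹) (lift-inverse σ⁻¹ σ σ⁻¹σ)

  open IsCommutativeRing isCommutativeRing using (+-isCommutativeMonoid; *-isCommutativeMonoid)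
  module +-Sum = SumProperties (CommutativeSemiring.+-commutativeMonoid commutativeSemiring)
  module *-Sum = SumProperties (CommutativeSemiring.*-commutativeMonoid commutativeSemiring)

  ∑ ∏ : (Carrier → Carrier) → Carrier
  ∑ = ⨁ +-isCommutativeMonoid
  ∏ = ⨁ *-isCommutativeMonoid

  -- Translation by 1 permutes K, so ∑ (x + 1) = ∑ x.
  N×1≡0 : N ×ₙ 1# ≡ 0#
  N×1≡0 = +-cancelˡ (∑ id) (N ×ₙ 1#) 0# (begin
    ∑ id + N ×ₙ 1#             ≡⟨ cong (∑ id +_) (+-Sum.sum-replicate N) ⟨
    ∑ id + ∑ (λ _ → 1#)       ≡⟨ +-Sum.∑-distrib-+ Elements.enum (λ _ → 1#) ⟨
    ∑ (λ x → x + 1#)          ≡⟨ ⨁-reindex +-isCommutativeMonoid id (_+ 1#) (_- 1#)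
                                   (λ x → //-rightDividesˡ 1# x) (λ x → //-rightDividesʳ 1# x) ⟨
    ∑ id                      ≡⟨ +-identityʳ (∑ id) ⟨
    ∑ id + 0#                 ∎)

  -- Multiplication by x ≢ 0 permutes K.  With unit y = y for y ≢ 0 and unit 0 = 1 this gives
  -- ∏ unit = ∏ (unit ∘ (x *_)) = x ^ (N - 1) · ∏ unit, and ∏ unit ≢ 0.
  private
    unit : Carrier → Carrier
    unit y with y ≟ 0#
    ... | yes _ = 1#
    ... | no  _ = y

    unit-nonzero : ∀ y → unit y ≢ 0#
    unit-nonzero y with y ≟ 0#
    ... | yes _   = 1≢0
    ... | no  y≢0 = y≢0

    factor : Carrier → Carrier → Carrier
    factor x y with y ≟ 0#
    ... | yes _ = 1#
    ... | no  _ = x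

    unit-* : ∀ {x} → x ≢ 0# → ∀ y → unit (x * y) ≡ factor x y * unit y
    unit-* {x} x≢0 y with y ≟ 0# | x * y ≟ 0#
    ... | yes _   | yes _     = sym (*-identityˡ 1#)
    ... | yes y≡0 | no  xy≢0  = ⊥-elim (xy≢0 (trans (cong (x *_) y≡0) (zeroʳ x)))
    ... | no  y≢0 | yes xy≡0  = ⊥-elim (*-nonzero x≢0 y≢0 xy≡0)
    ... | no  _   | no  _     = refl

    product-nonzero : ∀ {n} (g : Fin n → Carrier) → (∀ i → g i ≢ 0#) → *-Sum.sum g ≢ 0#
    product-nonzero {zero}  g _  = 1≢0
    product-nonzero {suc n} g g≢0 = *-nonzero (g≢0 zero) (product-nonzero (λ i → g (suc i)) (λ i → g≢0 (suc i)))

    x*product≡x^n : ∀ {n x} (g : Fin n → Carrier) (i : Fin n) → g i ≡ 1# → (∀ j → j ≢ i → g j ≡ x) →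
                    x * *-Sum.sum g ≡ x ^ n
    x*product≡x^n {suc n} {x} g i gi≡1 gj≡x = begin
      x * *-Sum.sum g                ≡⟨ cong (x *_) (*-Sum.sum-remove {i = i} g) ⟩
      x * (g i * rest)               ≡⟨ cong (λ z → x * (z * rest)) gi≡1 ⟩
      x * (1# * rest)                ≡⟨ cong (x *_) (*-identityˡ rest) ⟩
      x * rest                       ≡⟨ cong (x *_) (*-Sum.sum-cong-≗ {n} (λ j → gj≡x _ (Fin.punchInᵢ≢i i j))) ⟩
      x * *-Sum.sum {n} (λ _ → x)    ≡⟨ cong (x *_) (*-Sum.sum-replicate n) ⟩
      x * x ^′ n                     ≡⟨ cong (x *_) (^≡^′ x n) ⟨
      x ^ suc n                      ∎
      where rest = *-Sum.sum (λ j → g (Fin.punchIn i j))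

    x*∏factor≡x^N : ∀ x → x * ∏ (factor x) ≡ x ^ N
    x*∏factor≡x^N x = x*product≡x^n (λ i → factor x (Elements.enum i)) (index finite {0#} tt) factor0≡1 factor≢0≡x
      where
      factor0≡1 : factor x (Elements.enum (index finite {0#} tt)) ≡ 1#
      factor0≡1 with Elements.enum (index finite {0#} tt) ≟ 0#
      ... | yes _   = refl
      ... | no  ≢0  = ⊥-elim (≢0 (enum-index finite tt))
      factor≢0≡x : ∀ j → j ≢ index finite tt → factor x (Elements.enum j) ≡ x
      factor≢0≡x j j≢0 with Elements.enum j ≟ 0#
      ... | yes ≡0 = ⊥-elim (j≢0 (trans (sym (index-enum finite j)) (cong (λ z → index finite {z} tt) ≡0)))
      ... | no  _  = refl

  x^N≡x : ∀ x → x ^ N ≡ x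
  x^N≡x x with x ≟ 0#
  ... | yes refl = 0^n≡0 (N≥1 (index finite {0#} tt))
    where
    N≥1 : ∀ {n} → Fin n → n ≥ 1
    N≥1 {suc n} _ = s≤s z≤n
  ... | no x≢0 = begin
    x ^ N                 ≡⟨ x*∏factor≡x^N x ⟨
    x * ∏ (factor x)      ≡⟨ cong (x *_) ∏factor≡1 ⟩
    x * 1#                ≡⟨ *-identityʳ x ⟩
    x                     ∎
    where
    ∏unit≡∏factor*∏unit : ∏ unit ≡ ∏ (factor x) * ∏ unit
    ∏unit≡∏factor*∏unit = begin
      ∏ unit                         ≡⟨ ⨁-reindex *-isCommutativeMonoid unit (x *_) (x ⁻¹ *_)
                                          (x*[x⁻¹*y]≡y x≢0) (x⁻¹*[x*y]≡y x≢0) ⟩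
      ∏ (λ y → unit (x * y))         ≡⟨ *-Sum.sum-cong-≗ {N} (λ i → unit-* x≢0 (Elements.enum i)) ⟩
      ∏ (λ y → factor x y * unit y)  ≡⟨ *-Sum.∑-distrib-+ (λ i → factor x (Elements.enum i))
                                                           (λ i → unit (Elements.enum i)) ⟩
      ∏ (factor x) * ∏ unit          ∎
    ∏factor≡1 : ∏ (factor x) ≡ 1#
    ∏factor≡1 = *-cancelˡ (product-nonzero _ (λ i → unit-nonzero (Elements.enum i)))
      (trans (*-comm (∏ unit) _) (trans (sym ∏unit≡∏factor*∏unit) (sym (*-identityʳ (∏ unit)))))

-- The Frobenius endomorphism

module Frobenius (K : Field) {N : ℕ} (finite : HasCard (FieldDefs.All K) N)
                 {p : ℕ} (p-prime : Prime p) {m : ℕ} (N≡p^m : N ≡ p ℕ.^ m) where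
  open FieldDefs K
  open FieldProperties K
  open FiniteField K finite
  open MultProperties semiring using (×-assocˡ; ×-assoc-*; ×-comm-*; ×1-homo-*)
  open BinomialProperties commutativeSemiring using (binomialTerm; binomialExpansion; theorem)
  open ≡-Reasoning

  [n^m]×1≡[n×1]^m : ∀ n m → (n ℕ.^ m) ×ₙ 1# ≡ (n ×ₙ 1#) ^ m
  [n^m]×1≡[n×1]^m n zero    = +-identityʳ 1#
  [n^m]×1≡[n×1]^m n (suc m) = trans (×1-homo-* n (n ℕ.^ m)) (cong ((n ×ₙ 1#) *_) ([n^m]×1≡[n×1]^m n m))

  p×x≡0 : ∀ x → p ×ₙ x ≡ 0#
  p×x≡0 x = begin
    p ×ₙ x           ≡⟨ cong (p ×ₙ_) (*-identityˡ x) ⟨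
    p ×ₙ (1# * x)    ≡⟨ ×-assoc-* p 1# x ⟨
    (p ×ₙ 1#) * x    ≡⟨ cong (_* x) p×1≡0 ⟩
    0# * x           ≡⟨ zeroˡ x ⟩
    0#               ∎
    where
    p×1≡0 : p ×ₙ 1# ≡ 0#
    p×1≡0 with p ×ₙ 1# ≟ 0#
    ... | yes p×1≡0 = p×1≡0
    ... | no  p×1≢0 = ⊥-elim (^-nonzero m p×1≢0 (begin
      (p ×ₙ 1#) ^ m     ≡⟨ [n^m]×1≡[n×1]^m p m ⟨
      (p ℕ.^ m) ×ₙ 1#   ≡⟨ cong (_×ₙ 1#) N≡p^m ⟨
      N ×ₙ 1#           ≡⟨ N×1≡0 ⟩
      0#                ∎))

  pCk×x≡0 : ∀ {k} → 0 ℕ.< k → k ℕ.< p → ∀ x → (p C k) ×ₙ x ≡ 0#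
  pCk×x≡0 {k} 0<k k<p x with p∣pCk p-prime 0<k k<p
  ... | divides c pCk≡c*p = begin
    (p C k) ×ₙ x          ≡⟨ cong (_×ₙ x) pCk≡c*p ⟩
    (c ℕ.* p) ×ₙ x        ≡⟨ ×-assocˡ x c p ⟨
    c ×ₙ (p ×ₙ x)         ≡⟨ cong (c ×ₙ_) (p×x≡0 x) ⟩
    c ×ₙ 0#               ≡⟨ cong (c ×ₙ_) (zeroˡ 0#) ⟨
    c ×ₙ (0# * 0#)        ≡⟨ ×-comm-* c 0# 0# ⟨
    0# * (c ×ₙ 0#)        ≡⟨ zeroˡ _ ⟩
    0#                    ∎

  -- Only the outer terms of the binomial expansion of (x + y) ^ p survive.
  frobenius : ∀ x y → (x + y) ^ p ≡ x ^ p + y ^ p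
  frobenius x y = go (nonTrivial⇒n>1 p {{prime⇒nonTrivial p-prime}})
    where
    go : 1 ℕ.< p → (x + y) ^ p ≡ x ^ p + y ^ p
    go (s≤s {n = suc p-2} _) = begin
      (x + y) ^ p                                 ≡⟨ ^≡^′ (x + y) p ⟩
      (x + y) ^′ p                                ≡⟨ theorem p x y ⟩
      binomialExpansion x y p                     ≡⟨ cong (term zero +_) (inner≡last (suc p-2) (λ i → term (suc i)) inner≡0) ⟩
      term zero + term (suc (Fin.fromℕ (suc p-2))) ≡⟨ cong₂ _+_ first≡y^p last≡x^p ⟩
      y ^ p + x ^ p                               ≡⟨ +-comm _ _ ⟩
      x ^ p + y ^ p                               ∎
      where
      term = binomialTerm x y p
      inner≡last : ∀ n (g : Fin (suc n) → Carrier) → (∀ i → toℕ i ℕ.< n → g i ≡ 0#) →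
                   +-Sum.sum g ≡ g (Fin.fromℕ n)
      inner≡last zero    g _     = +-identityʳ (g zero)
      inner≡last (suc n) g g≡0 = trans
        (cong₂ _+_ (g≡0 zero (s≤s z≤n)) (inner≡last n (λ i → g (suc i)) (λ i i<n → g≡0 (suc i) (s≤s i<n))))
        (+-identityˡ _)
      inner≡0 : ∀ i → toℕ i ℕ.< suc p-2 → term (suc i) ≡ 0#
      inner≡0 i i<p-1 = pCk×x≡0 (s≤s z≤n) (s≤s i<p-1) _
      first≡y^p : term zero ≡ y ^ p
      first≡y^p = trans (+-identityʳ _) (trans (*-identityˡ _) (sym (^≡^′ y p)))
      last≡x^p : term (suc (Fin.fromℕ (suc p-2))) ≡ x ^ p
      last≡x^p = begin
        term (suc (Fin.fromℕ (suc p-2)))  ≡⟨ cong (λ k → (p C k) ×ₙ (x ^′ k * y ^′ (p ∸ k))) (cong suc (Fin.toℕ-fromℕ (suc p-2))) ⟩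
        (p C p) ×ₙ (x ^′ p * y ^′ (p ∸ p)) ≡⟨ cong (λ c → c ×ₙ (x ^′ p * y ^′ (p ∸ p))) (nCn≡1 p) ⟩
        1 ×ₙ (x ^′ p * y ^′ (p ∸ p))       ≡⟨ +-identityʳ _ ⟩
        x ^′ p * y ^′ (p ∸ p)              ≡⟨ cong (λ k → x ^′ p * y ^′ k) (ℕ.n∸n≡0 p) ⟩
        x ^′ p * 1#                        ≡⟨ *-identityʳ _ ⟩
        x ^′ p                             ≡⟨ ^≡^′ x p ⟨
        x ^ p                              ∎

  frobenius-p^ : ∀ j x y → (x + y) ^ (p ℕ.^ j) ≡ x ^ (p ℕ.^ j) + y ^ (p ℕ.^ j)
  frobenius-p^ zero    x y = trans (*-identityʳ _) (cong₂ _+_ (sym (*-identityʳ x)) (sym (*-identityʳ y)))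
  frobenius-p^ (suc j) x y = begin
    (x + y) ^ (p ℕ.* p ℕ.^ j)               ≡⟨ ^-*-assoc (x + y) p (p ℕ.^ j) ⟨
    ((x + y) ^ p) ^ (p ℕ.^ j)               ≡⟨ cong (_^ (p ℕ.^ j)) (frobenius x y) ⟩
    (x ^ p + y ^ p) ^ (p ℕ.^ j)             ≡⟨ frobenius-p^ j _ _ ⟩
    (x ^ p) ^ (p ℕ.^ j) + (y ^ p) ^ (p ℕ.^ j) ≡⟨ cong₂ _+_ (^-*-assoc x p _) (^-*-assoc y p _) ⟩
    x ^ (p ℕ.* p ℕ.^ j) + y ^ (p ℕ.* p ℕ.^ j) ∎

-- Polynomials

module Polynomials (K : Field) where
  open import Data.List using (List; []; _∷_; length)
  open import Data.List.Relation.Unary.All as List using ([]; _∷_)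
  open FieldDefs K
  open FieldProperties K
  open ≡-Reasoning

  -- Coefficient lists, constant term first.
  Poly : Set
  Poly = List Carrier

  eval : Poly → Carrier → Carrier
  eval []       x = 0#
  eval (c ∷ cs) x = c + x * eval cs x

  IsZero : Poly → Set
  IsZero = List.All (_≡ 0#)

  -- Synthetic division by X - a.
  quotient : Carrier → Poly → Poly
  quotient a []               = []
  quotient a (c ∷ [])         = []
  quotient a (c ∷ cs@(_ ∷ _)) = eval cs a ∷ quotient a cs

  eval-quotient : ∀ a cs x → eval cs x ≡ eval cs a + (x - a) * eval (quotient a cs) x
  eval-quotient a [] x = sym (trans (cong (0# +_) (zeroʳ _)) (+-identityˡ 0#))
  eval-quotient a (c ∷ []) x = begin
    c + x * 0#                       ≡⟨ cong (c +_) (zeroʳ x) ⟩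
    c + 0#                           ≡⟨ cong (c +_) (zeroʳ a) ⟨
    c + a * 0#                       ≡⟨ +-identityʳ _ ⟨
    (c + a * 0#) + 0#                ≡⟨ cong ((c + a * 0#) +_) (zeroʳ (x - a)) ⟨
    (c + a * 0#) + (x - a) * 0#      ∎
  eval-quotient a (c ∷ cs@(_ ∷ _)) x = begin
    c + x * eval cs x                                   ≡⟨ cong (λ z → c + x * z) (eval-quotient a cs x) ⟩
    c + x * (cs[a] + (x - a) * q[x])                    ≡⟨ cong (c +_) regroup ⟩
    c + (a * cs[a] + (x - a) * (cs[a] + x * q[x]))      ≡⟨ +-assoc c _ _ ⟨
    (c + a * cs[a]) + (x - a) * (cs[a] + x * q[x])      ∎
    where
    cs[a] = eval cs a
    q[x]  = eval (quotient a cs) x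
    regroup : x * (cs[a] + (x - a) * q[x]) ≡ a * cs[a] + (x - a) * (cs[a] + x * q[x])
    regroup = begin
      x * (cs[a] + (x - a) * q[x])                          ≡⟨ distribˡ x cs[a] _ ⟩
      x * cs[a] + x * ((x - a) * q[x])                      ≡⟨ cong₂ _+_ (cong (_* cs[a]) x≡a+[x-a]) (x∙yz≈y∙xz x (x - a) q[x]) ⟩
      (a + (x - a)) * cs[a] + (x - a) * (x * q[x])          ≡⟨ cong (_+ (x - a) * (x * q[x])) (distribʳ cs[a] a (x - a)) ⟩
      (a * cs[a] + (x - a) * cs[a]) + (x - a) * (x * q[x])  ≡⟨ +-assoc _ _ _ ⟩
      a * cs[a] + ((x - a) * cs[a] + (x - a) * (x * q[x]))  ≡⟨ cong (a * cs[a] +_) (distribˡ (x - a) cs[a] (x * q[x])) ⟨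
      a * cs[a] + (x - a) * (cs[a] + x * q[x])              ∎
      where
      x≡a+[x-a] : x ≡ a + (x - a)
      x≡a+[x-a] = sym (trans (+-comm a (x - a)) (//-rightDividesˡ a x))

  length-quotient : ∀ a cs → length (quotient a cs) ≡ length cs ∸ 1
  length-quotient a []               = refl
  length-quotient a (c ∷ [])         = refl
  length-quotient a (c ∷ cs@(_ ∷ _)) = cong suc (length-quotient a cs)

  quotient-zero : ∀ a cs → IsZero (quotient a cs) → eval cs a ≡ 0# → IsZero cs
  quotient-zero a []           _              _         = []
  quotient-zero a (c ∷ [])     _              c+a*0≡0   =
    trans (sym (trans (cong (c +_) (zeroʳ a)) (+-identityʳ c))) c+a*0≡0 ∷ []
  quotient-zero a (c ∷ d ∷ cs) (cs[a]≡0 ∷ qz) c+a*cs[a]≡0 =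
    trans (sym (trans (cong (λ z → c + a * z) cs[a]≡0) (trans (cong (c +_) (zeroʳ a)) (+-identityʳ c)))) c+a*cs[a]≡0
    ∷ quotient-zero a (d ∷ cs) qz cs[a]≡0

  roots⇒zero : ∀ {n} cs → length cs ≡ n → (g : Fin n → Carrier) → (∀ i j → g i ≡ g j → i ≡ j) →
               (∀ i → eval cs (g i) ≡ 0#) → IsZero cs
  roots⇒zero {zero}  []           _       _ _     _       = []
  roots⇒zero {suc n} cs@(_ ∷ cs′) 1+cs′≡n g g-inj g-roots = quotient-zero a cs
    (roots⇒zero (quotient a cs) (trans (length-quotient a cs) (ℕ.suc-injective 1+cs′≡n))
       (λ i → g (suc i)) (λ i j eq → Fin.suc-injective (g-inj _ _ eq)) quotient-roots)
    (g-roots zero)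
    where
    a = g zero
    quotient-roots : ∀ i → eval (quotient a cs) (g (suc i)) ≡ 0#
    quotient-roots i = x*y≡0⇒y≡0 (λ x-a≡0 → Fin.0≢1+n (g-inj _ _ (sym (x∙y⁻¹≈ε⇒x≈y _ _ x-a≡0)))) (begin
      (x - a) * eval (quotient a cs) x             ≡⟨ +-identityˡ _ ⟨
      0# + (x - a) * eval (quotient a cs) x        ≡⟨ cong (_+ (x - a) * eval (quotient a cs) x) (g-roots zero) ⟨
      eval cs a + (x - a) * eval (quotient a cs) x ≡⟨ eval-quotient a cs x ⟨
      eval cs x                                   ≡⟨ g-roots (suc i) ⟩
      0#                                          ∎)
      where x = g (suc i)

  roots-bound : ∀ cs {r} → HasCard (λ x → eval cs x ≡ 0#) r → ¬ IsZero cs → r ℕ.< length cs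
  roots-bound cs {r} roots cs≢0 with r ℕ.<? length cs
  ... | yes r<len = r<len
  ... | no  r≮len = ⊥-elim (cs≢0 (roots⇒zero cs refl g g-inj (λ i → R.enum-P _)))
    where
    module R = HasCard roots
    len≤r = ℕ.≮⇒≥ r≮len
    g : Fin (length cs) → Carrier
    g i = R.enum (Fin.inject≤ i len≤r)
    g-inj : ∀ i j → g i ≡ g j → i ≡ j
    g-inj i j eq = Fin.inject≤-injective len≤r len≤r i j (R.enum-inj _ _ eq)

  X^_ : ℕ → Poly
  X^ zero    = 1# ∷ []
  X^ (suc n) = 0# ∷ X^ n

  infixl 6 _+ₚ_
  _+ₚ_ : Poly → Poly → Poly
  cs       +ₚ []       = cs
  []       +ₚ (d ∷ ds) = d ∷ ds
  (c ∷ cs) +ₚ (d ∷ ds) = (c + d) ∷ (cs +ₚ ds)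

  eval-X^ : ∀ n x → eval (X^ n) x ≡ x ^ n
  eval-X^ zero    x = trans (cong (1# +_) (zeroʳ x)) (+-identityʳ 1#)
  eval-X^ (suc n) x = trans (+-identityˡ _) (cong (x *_) (eval-X^ n x))

  eval-+ₚ : ∀ cs ds x → eval (cs +ₚ ds) x ≡ eval cs x + eval ds x
  eval-+ₚ cs       []       x = sym (+-identityʳ _)
  eval-+ₚ []       (d ∷ ds) x = sym (+-identityˡ _)
  eval-+ₚ (c ∷ cs) (d ∷ ds) x = begin
    (c + d) + x * eval (cs +ₚ ds) x               ≡⟨ cong (λ z → (c + d) + x * z) (eval-+ₚ cs ds x) ⟩
    (c + d) + x * (eval cs x + eval ds x)         ≡⟨ cong ((c + d) +_) (distribˡ x _ _) ⟩
    (c + d) + (x * eval cs x + x * eval ds x)     ≡⟨ +-interchange c d _ _ ⟩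
    (c + x * eval cs x) + (d + x * eval ds x)     ∎

  length-monic : ∀ n cs → length cs ℕ.≤ n → length (X^ n +ₚ cs) ≡ suc n
  length-monic zero    []       _         = refl
  length-monic (suc n) []       _         = cong suc (length-monic n [] z≤n)
  length-monic (suc n) (c ∷ cs) (s≤s len≤n) = cong suc (length-monic n cs len≤n)

  monic≢0 : ∀ n cs → length cs ℕ.≤ n → ¬ IsZero (X^ n +ₚ cs)
  monic≢0 zero    []       _           (1≡0 ∷ _) = 1≢0 1≡0
  monic≢0 (suc n) []       _           (_ ∷ z)   = monic≢0 n [] z≤n z
  monic≢0 (suc n) (c ∷ cs) (s≤s len≤n) (_ ∷ z)   = monic≢0 n cs len≤n z

  monic-roots-bound : ∀ n cs {r} → length cs ℕ.≤ n → HasCard (λ x → eval (X^ n +ₚ cs) x ≡ 0#) r → r ℕ.≤ n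
  monic-roots-bound n cs len≤n roots =
    ℕ.≤-pred (subst (_ ℕ.<_) (length-monic n cs len≤n) (roots-bound _ roots (monic≢0 n cs len≤n)))

-- Subfields of a finite field of order q ^ n

module GaloisField (K : Field) {q n : ℕ} (q-primePower : IsPrimePower q)
                   (finite : HasCard (FieldDefs.All K) (q ℕ.^ n)) where
  open FieldDefs K
  open FieldProperties K
  open FiniteField K finite
  open Polynomials K
  open import Data.List using ([]; _∷_; length)
  open ≡-Reasoning

  private
    p = proj₁ q-primePower
    e = proj₁ (proj₂ q-primePower)
    p-prime : Prime p
    p-prime = proj₁ (proj₂ (proj₂ q-primePower))
    e≥1 : e ≥ 1
    e≥1 = proj₁ (proj₂ (proj₂ (proj₂ q-primePower)))
    q≡p^e : q ≡ p ℕ.^ e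
    q≡p^e = proj₂ (proj₂ (proj₂ (proj₂ q-primePower)))

    q^k≡p^[e*k] : ∀ k → q ℕ.^ k ≡ p ℕ.^ (e ℕ.* k)
    q^k≡p^[e*k] k = trans (cong (ℕ._^ k) q≡p^e) (ℕ.^-*-assoc p e k)

    open Frobenius K finite p-prime {e ℕ.* n} (q^k≡p^[e*k] n) using (frobenius-p^)

  1<q : 1 ℕ.< q
  1<q = subst (1 ℕ.<_) (sym q≡p^e) (ℕ.^-monoʳ-< p (nonTrivial⇒n>1 p {{prime⇒nonTrivial p-prime}}) e≥1)

  q^k≥1 : ∀ k → q ℕ.^ k ≥ 1
  q^k≥1 k = ℕ.^-monoʳ-≤ q {{ℕ.>-nonZero (ℕ.<-trans (s≤s z≤n) 1<q)}} {0} {k} z≤n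

  frobenius-q^ : ∀ k x y → (x + y) ^ (q ℕ.^ k) ≡ x ^ (q ℕ.^ k) + y ^ (q ℕ.^ k)
  frobenius-q^ k x y rewrite q^k≡p^[e*k] k = frobenius-p^ (e ℕ.* k) x y

  -‿^q^k : ∀ k x → (- x) ^ (q ℕ.^ k) ≡ - (x ^ (q ℕ.^ k))
  -‿^q^k k x = inverseʳ-unique (x ^ (q ℕ.^ k)) ((- x) ^ (q ℕ.^ k)) (begin
    x ^ (q ℕ.^ k) + (- x) ^ (q ℕ.^ k)  ≡⟨ frobenius-q^ k x (- x) ⟨
    (x - x) ^ (q ℕ.^ k)                ≡⟨ cong (_^ (q ℕ.^ k)) (-‿inverseʳ x) ⟩
    0# ^ (q ℕ.^ k)                     ≡⟨ 0^n≡0 (q^k≥1 k) ⟩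
    0#                                 ∎)

  frobenius-q^-sub : ∀ k x y → (x - y) ^ (q ℕ.^ k) ≡ x ^ (q ℕ.^ k) - y ^ (q ℕ.^ k)
  frobenius-q^-sub k x y = trans (frobenius-q^ k x (- y)) (cong (x ^ (q ℕ.^ k) +_) (-‿^q^k k y))

  Sub-isSubfield : ∀ k → IsSubfield (Sub q k)
  Sub-isSubfield k = record
    { 0∈        = 0^n≡0 (q^k≥1 k)
    ; 1∈        = 1^n≡1 Q
    ; +-closed  = λ {x} {y} x∈ y∈ → trans (frobenius-q^ k x y) (cong₂ _+_ x∈ y∈)
    ; -‿closed  = λ {x} x∈ → trans (-‿^q^k k x) (cong -_ x∈)
    ; *-closed  = λ {x} {y} x∈ y∈ → trans (^-distribʳ-* x y Q) (cong₂ _*_ x∈ y∈)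
    ; ⁻¹-closed = ⁻¹-closed
    }
    where
    Q = q ℕ.^ k
    ⁻¹-closed : ∀ {x} → Sub q k x → Sub q k (x ⁻¹)
    ⁻¹-closed {x} x∈ = by-cases (x ≟ 0#)
      where
      by-cases : Dec (x ≡ 0#) → Sub q k (x ⁻¹)
      by-cases (yes refl) = subst (Sub q k) (sym 0⁻¹≡0) (0^n≡0 (q^k≥1 k))
      by-cases (no  x≢0)  = *-cancelˡ x≢0 (begin
        x * (x ⁻¹) ^ Q         ≡⟨ cong (_* (x ⁻¹) ^ Q) x∈ ⟨
        x ^ Q * (x ⁻¹) ^ Q     ≡⟨ ^-distribʳ-* x (x ⁻¹) Q ⟨
        (x * x ⁻¹) ^ Q         ≡⟨ cong (_^ Q) (x*x⁻¹≡1 x≢0) ⟩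
        1# ^ Q                 ≡⟨ 1^n≡1 Q ⟩
        1#                     ≡⟨ x*x⁻¹≡1 x≢0 ⟨
        x * x ⁻¹               ∎)

  Sub-1⊆Sub : ∀ k → Sub q 1 ⊆ Sub q k
  Sub-1⊆Sub zero    {x} _  = *-identityʳ x
  Sub-1⊆Sub (suc k) {x} x∈ = begin
    x ^ (q ℕ.* q ℕ.^ k)   ≡⟨ ^-*-assoc x q (q ℕ.^ k) ⟨
    (x ^ q) ^ (q ℕ.^ k)   ≡⟨ cong (_^ (q ℕ.^ k)) x^q≡x ⟩
    x ^ (q ℕ.^ k)         ≡⟨ Sub-1⊆Sub k x∈ ⟩
    x                     ∎
    where
    x^q≡x : x ^ q ≡ x
    x^q≡x = trans (cong (x ^_) (sym (ℕ.*-identityʳ q))) x∈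

  -- With Q = q ^ k: |F_Q| ≤ Q as F_Q is the set of roots of X ^ Q - X.  Conversely, ψ x = x ^ Q - x
  -- is additive with kernel F_Q and T(ψ x) = x ^ (Q ^ j) - x = 0 for T = X ^ (Q ^ (j - 1)) + … + X ^ Q + X,
  -- so x ↦ (x - y, ψ x), for a chosen y with ψ y = ψ x, embeds K into F_Q × {roots of T}, whence
  -- q ^ n = Q ^ j ≤ |F_Q| · Q ^ (j - 1).
  module SubfieldCard {k j : ℕ} (k*j≡n : k ℕ.* j ≡ n) (k≥1 : k ≥ 1) (j≥1 : j ≥ 1) where
    private
      Q = q ℕ.^ k
      F = Sub q k

      1<Q : 1 ℕ.< Q
      1<Q = ℕ.^-monoʳ-< q 1<q k≥1

      F? : Decidable F
      F? x = x ^ Q ≟ x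

      F-card : ∃[ s ] HasCard F s
      F-card = let s , card = HasCard-∩-decidable finite F? in s , HasCard-resp-⇔ card proj₂ (tt ,_)
      s = proj₁ F-card

      ψ : Carrier → Carrier
      ψ x = x ^ Q - x

      ψ≡0⇒∈F : ∀ {x} → ψ x ≡ 0# → F x
      ψ≡0⇒∈F = x∙y⁻¹≈ε⇒x≈y _ _

      ψ-sub : ∀ x y → ψ (x - y) ≡ ψ x - ψ y
      ψ-sub x y = begin
        (x - y) ^ Q - (x - y)          ≡⟨ cong (_- (x - y)) (frobenius-q^-sub k x y) ⟩
        (x ^ Q - y ^ Q) - (x - y)      ≡⟨ cong ((x ^ Q - y ^ Q) +_) (sym (⁻¹-∙-comm x (- y))) ⟩
        (x ^ Q - y ^ Q) + (- x - - y)  ≡⟨ +-interchange (x ^ Q) (- (y ^ Q)) (- x) (- - y) ⟩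
        (x ^ Q - x) + (- (y ^ Q) - - y) ≡⟨ cong ((x ^ Q - x) +_) (⁻¹-∙-comm (y ^ Q) (- y)) ⟩
        ψ x - ψ y                      ∎

      -X : Poly
      -X = 0# ∷ - 1# ∷ []

      X^Q-X : Poly
      X^Q-X = X^ Q +ₚ -X

      eval-X^Q-X : ∀ x → eval X^Q-X x ≡ ψ x
      eval-X^Q-X x = begin
        eval X^Q-X x                    ≡⟨ eval-+ₚ (X^ Q) -X x ⟩
        eval (X^ Q) x + eval -X x       ≡⟨ cong₂ _+_ (eval-X^ Q x) (+-identityˡ _) ⟩
        x ^ Q + x * (- 1# + x * 0#)     ≡⟨ cong (λ z → x ^ Q + x * z) (trans (cong (- 1# +_) (zeroʳ x)) (+-identityʳ _)) ⟩
        x ^ Q + x * - 1#                ≡⟨ cong (x ^ Q +_) (trans (*-comm x (- 1#)) (-1*x≈-x x)) ⟩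
        ψ x                             ∎

      s≤Q : s ℕ.≤ Q
      s≤Q = monic-roots-bound Q -X 1<Q (HasCard-resp-⇔ (proj₂ F-card)
        (λ {x} x∈ → trans (eval-X^Q-X x) (trans (cong (_- x) x∈) (-‿inverseʳ x)))
        (λ {x} root → ψ≡0⇒∈F (trans (sym (eval-X^Q-X x)) root)))

      trace : ℕ → Poly
      trace zero    = []
      trace (suc i) = X^ (Q ℕ.^ i) +ₚ trace i

      Q^i≥1 : ∀ i → Q ℕ.^ i ≥ 1
      Q^i≥1 i = subst (_≥ 1) (sym (ℕ.^-*-assoc q k i)) (q^k≥1 (k ℕ.* i))

      length-trace : ∀ i → length (trace i) ℕ.≤ Q ℕ.^ i
      length-trace zero    = z≤n
      length-trace (suc i) = subst (ℕ._≤ Q ℕ.^ suc i) (sym (length-monic (Q ℕ.^ i) (trace i) (length-trace i)))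
                                   (1+m≤n*m 1<Q (Q^i≥1 i))

      frobenius-Q^-sub : ∀ i x y → (x - y) ^ (Q ℕ.^ i) ≡ x ^ (Q ℕ.^ i) - y ^ (Q ℕ.^ i)
      frobenius-Q^-sub i x y rewrite ℕ.^-*-assoc q k i = frobenius-q^-sub (k ℕ.* i) x y

      eval-trace-ψ : ∀ i x → eval (trace i) (ψ x) ≡ x ^ (Q ℕ.^ i) - x
      eval-trace-ψ zero    x = sym (trans (cong (_- x) (*-identityʳ x)) (-‿inverseʳ x))
      eval-trace-ψ (suc i) x = begin
        eval (X^ (Q ℕ.^ i) +ₚ trace i) (ψ x)                         ≡⟨ eval-+ₚ (X^ (Q ℕ.^ i)) (trace i) (ψ x) ⟩
        eval (X^ (Q ℕ.^ i)) (ψ x) + eval (trace i) (ψ x)             ≡⟨ cong₂ _+_ (eval-X^ (Q ℕ.^ i) (ψ x)) (eval-trace-ψ i x) ⟩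
        (x ^ Q - x) ^ (Q ℕ.^ i) + (x ^ (Q ℕ.^ i) - x)                ≡⟨ cong (_+ (x ^ (Q ℕ.^ i) - x)) (frobenius-Q^-sub i (x ^ Q) x) ⟩
        ((x ^ Q) ^ (Q ℕ.^ i) - x ^ (Q ℕ.^ i)) + (x ^ (Q ℕ.^ i) - x)  ≡⟨ [x-y]+[y-z]≡x-z _ _ _ ⟩
        (x ^ Q) ^ (Q ℕ.^ i) - x                                      ≡⟨ cong (_- x) (^-*-assoc x Q (Q ℕ.^ i)) ⟩
        x ^ (Q ℕ.^ suc i) - x                                        ∎

      j′ = ℕ.pred j

      Q^[1+j′]≡q^n : Q ℕ.^ suc j′ ≡ q ℕ.^ n
      Q^[1+j′]≡q^n = begin
        Q ℕ.^ suc j′          ≡⟨ cong (Q ℕ.^_) (ℕ.suc-pred j {{ℕ.>-nonZero j≥1}}) ⟩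
        Q ℕ.^ j               ≡⟨ ℕ.^-*-assoc q k j ⟩
        q ℕ.^ (k ℕ.* j)       ≡⟨ cong (q ℕ.^_) k*j≡n ⟩
        q ℕ.^ n               ∎

      IsTraceRoot : Pred Carrier 0ℓ
      IsTraceRoot y = eval (trace (suc j′)) y ≡ 0#

      trace-ψ≡0 : ∀ x → IsTraceRoot (ψ x)
      trace-ψ≡0 x = begin
        eval (trace (suc j′)) (ψ x)  ≡⟨ eval-trace-ψ (suc j′) x ⟩
        x ^ (Q ℕ.^ suc j′) - x       ≡⟨ cong (λ m → x ^ m - x) Q^[1+j′]≡q^n ⟩
        x ^ (q ℕ.^ n) - x            ≡⟨ cong (_- x) (x^N≡x x) ⟩
        x - x                        ≡⟨ -‿inverseʳ x ⟩
        0#                           ∎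

      ψ-preimage : Carrier → Carrier
      ψ-preimage y with ∃? (λ x → ψ x ≟ y)
      ... | yes (x , _) = x
      ... | no  _       = 0#

      ψ∘ψ-preimage : ∀ x → ψ (ψ-preimage (ψ x)) ≡ ψ x
      ψ∘ψ-preimage x with ∃? (λ z → ψ z ≟ ψ x)
      ... | yes (_ , ψz≡ψx) = ψz≡ψx
      ... | no  ∄z          = ⊥-elim (∄z (x , refl))

      split : Carrier → Carrier × Carrier
      split x = x - ψ-preimage (ψ x) , ψ x

      split-injection : InjectionOn All (F ⟨×⟩ IsTraceRoot) split
      split-injection = record
        { maps-to   = λ {x} _ → ψ≡0⇒∈F (trans (ψ-sub x _) (trans (cong (_-_ (ψ x)) (ψ∘ψ-preimage x)) (-‿inverseʳ (ψ x))))
                              , trace-ψ≡0 x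
        ; injective = λ {x} {y} _ _ eq → +-cancelʳ (- ψ-preimage (ψ x)) x y
            (trans (cong proj₁ eq) (cong (λ z → y - ψ-preimage z) (sym (cong proj₂ eq))))
        }

      roots = HasCard-∩-decidable finite (λ y → eval (trace (suc j′)) y ≟ 0#)
      r = proj₁ roots

      roots-card : HasCard IsTraceRoot r
      roots-card = HasCard-resp-⇔ (proj₂ roots) proj₂ (tt ,_)

      q^n≤s*r : q ℕ.^ n ℕ.≤ s ℕ.* r
      q^n≤s*r = HasCard-injection⇒≤ finite (HasCard-⟨×⟩ (proj₂ F-card) roots-card) split-injection

      r≤Q^j′ : r ℕ.≤ Q ℕ.^ j′
      r≤Q^j′ = monic-roots-bound (Q ℕ.^ j′) (trace j′) (length-trace j′) roots-card

      Q≤s : Q ℕ.≤ s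
      Q≤s = ℕ.*-cancelʳ-≤ Q s (Q ℕ.^ j′) {{ℕ.>-nonZero (Q^i≥1 j′)}}
              (ℕ.≤-trans (ℕ.≤-reflexive Q^[1+j′]≡q^n) (ℕ.≤-trans q^n≤s*r (ℕ.*-monoʳ-≤ s r≤Q^j′)))

    Sub-card : HasCard (Sub q k) (q ℕ.^ k)
    Sub-card = subst (HasCard F) (ℕ.≤-antisym s≤Q Q≤s) (proj₂ F-card)

-- Subspaces of K² over a subfield F

module LinearAlgebra (K : Field) {N : ℕ} (finite : HasCard (FieldDefs.All K) N)
                     {F : Pred (FieldDefs.Carrier K) 0ℓ} (F-subfield : FiniteField.IsSubfield K finite F)
                     {r : ℕ} (F-card : HasCard F r) where
  open FieldDefs K
  open FieldProperties K
  open FiniteField K finite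
  open VectorProperties K
  open IsSubfield F-subfield
  open import Data.Vec.Functional using (_∷_; tail)
  open ≡-Reasoning

  _≟v_ : DecidableEquality V2
  _≟v_ = ×-≡-dec _≟_ _≟_

  1<r : 1 ℕ.< r
  1<r = HasCard-⊆⇒≤ (HasCard-∪ (HasCard-｛｝ 0#) (HasCard-｛｝ 1#) (λ { refl 1≡0 → 1≢0 1≡0 })) F-card
          (λ { (inj₁ refl) → 0∈ ; (inj₂ refl) → 1∈ })

  linComb : ∀ {d} → (Fin d → Carrier) → (Fin d → V2) → V2
  linComb {d} c b = sumV d (λ i → c i · b i)

  linComb-cong : ∀ {d} {c c′ : Fin d → Carrier} (b : Fin d → V2) → (∀ i → c i ≡ c′ i) → linComb c b ≡ linComb c′ b
  linComb-cong {zero}  b c≡c′ = refl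
  linComb-cong {suc d} b c≡c′ = cong₂ _+v_ (cong (_· b zero) (c≡c′ zero)) (linComb-cong (tail b) (λ i → c≡c′ (suc i)))

  linComb-+ : ∀ {d} (c c′ : Fin d → Carrier) b → linComb c b +v linComb c′ b ≡ linComb (λ i → c i + c′ i) b
  linComb-+ {zero}  c c′ b = +v-identityˡ 0v
  linComb-+ {suc d} c c′ b = trans (+v-interchange _ _ _ _)
    (cong₂ _+v_ (sym (·-distribʳ (c zero) (c′ zero) (b zero))) (linComb-+ (tail c) (tail c′) (tail b)))

  linComb-· : ∀ {d} a (c : Fin d → Carrier) b → a · linComb c b ≡ linComb (λ i → a * c i) b
  linComb-· {zero}  a c b = c·0≡0 a
  linComb-· {suc d} a c b = trans (·-distribˡ a _ _)
    (cong₂ _+v_ (·-assoc a (c zero) (b zero)) (linComb-· a (tail c) (tail b)))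

  InF : ∀ {d} → (Fin d → Carrier) → Set
  InF c = ∀ i → F (c i)

  ∷-InF : ∀ {c₀ d} {c : Fin d → Carrier} → F c₀ → InF c → InF (c₀ ∷ c)
  ∷-InF c₀∈F c∈F zero    = c₀∈F
  ∷-InF c₀∈F c∈F (suc i) = c∈F i

  Span : ∀ {d} → (Fin d → V2) → Pred V2 0ℓ
  Span b v = ∃[ c ] (InF c × v ≡ linComb c b)

  Independent : ∀ {d} → (Fin d → V2) → Set
  Independent b = ∀ c c′ → InF c → InF c′ → linComb c b ≡ linComb c′ b → ∀ i → c i ≡ c′ i

  Independent₀ : ∀ {d} → (Fin d → V2) → Set
  Independent₀ b = ∀ c → InF c → linComb c b ≡ 0v → ∀ i → c i ≡ 0#

  independent₀⇒independent : ∀ {d} {b : Fin d → V2} → Independent₀ b → Independent b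
  independent₀⇒independent {b = b} indep₀ c c′ c∈F c′∈F eq i =
    x∙y⁻¹≈ε⇒x≈y _ _ (trans (cong (c i +_) (sym (-1*x≈-x (c′ i)))) (indep₀ c-c′ c-c′∈F c-c′≡0 i))
    where
    c-c′ = λ i → c i + (- 1#) * c′ i
    c-c′∈F : InF c-c′
    c-c′∈F i = +-closed (c∈F i) (*-closed (-‿closed 1∈) (c′∈F i))
    c-c′≡0 : linComb c-c′ b ≡ 0v
    c-c′≡0 = begin
      linComb c-c′ b                                    ≡⟨ linComb-+ c _ b ⟨
      linComb c b +v linComb (λ i → (- 1#) * c′ i) b   ≡⟨ cong (linComb c b +v_) (linComb-· (- 1#) c′ b) ⟨
      linComb c b -v linComb c′ b                       ≡⟨ cong (linComb c b -v_) eq ⟨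
      linComb c b -v linComb c b                        ≡⟨ u-u≡0 _ ⟩
      0v                                                ∎

  record IsSubspace (W : Pred V2 0ℓ) : Set where
    field
      0v∈       : W 0v
      +v-closed : ∀ {u v} → W u → W v → W (u +v v)
      ·-closed  : ∀ {c u} → F c → W u → W (c · u)

    linComb∈ : ∀ {d} (b : Fin d → V2) → (∀ i → W (b i)) → ∀ c → InF c → W (linComb c b)
    linComb∈ {zero}  b b∈W c c∈F = 0v∈
    linComb∈ {suc d} b b∈W c c∈F = +v-closed (·-closed (c∈F zero) (b∈W zero))
                                             (linComb∈ (tail b) (λ i → b∈W (suc i)) (tail c) (λ i → c∈F (suc i)))

    Span⊆ : ∀ {d} {b : Fin d → V2} → (∀ i → W (b i)) → Span b ⊆ W
    Span⊆ {b = b} b∈W (c , c∈F , v≡) = subst W (sym v≡) (linComb∈ b b∈W c c∈F)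

  ∩-isSubspace : ∀ {V W} → IsSubspace V → IsSubspace W → IsSubspace (V ∩ W)
  ∩-isSubspace V W = record
    { 0v∈       = V.0v∈ , W.0v∈
    ; +v-closed = λ (u∈V , u∈W) (v∈V , v∈W) → V.+v-closed u∈V v∈V , W.+v-closed u∈W v∈W
    ; ·-closed  = λ c∈F (u∈V , u∈W) → V.·-closed c∈F u∈V , W.·-closed c∈F u∈W
    }
    where
    module V = IsSubspace V
    module W = IsSubspace W

  span-isSubspace : ∀ {E} → IsSubfield E → F ⊆ E → ∀ v → IsSubspace (span E v)
  span-isSubspace E-subfield F⊆E v = record
    { 0v∈       = 0# , E.0∈ , sym (0·u≡0 v)
    ; +v-closed = λ { (a , a∈E , refl) (b , b∈E , refl) → a + b , E.+-closed a∈E b∈E , sym (·-distribʳ a b v) }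
    ; ·-closed  = λ { {c} c∈F (a , a∈E , refl) → c * a , E.*-closed (F⊆E c∈F) a∈E , ·-assoc c a v }
    }
    where module E = IsSubfield E-subfield

  module _ {E : Pred Carrier 0ℓ} (E-subfield : IsSubfield E) {α : Carrier} (α∈E : E α) where
    private module E = IsSubfield E-subfield

    span-·⁺ : α ≢ 0# → ∀ {v} → span E v ⊆ span E (α · v)
    span-·⁺ α≢0 {v} (k , k∈E , refl) = k * α ⁻¹ , E.*-closed k∈E (E.⁻¹-closed α∈E) ,
      sym (trans (·-assoc (k * α ⁻¹) α v) (cong (_· v) ([y*x⁻¹]*x≡y α≢0 k)))

    span-·⁻ : ∀ {v} → span E (α · v) ⊆ span E v
    span-·⁻ {v} (k , k∈E , refl) = k * α , E.*-closed k∈E α∈E , ·-assoc k α v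

  Span-card : ∀ {d} (b : Fin d → V2) → Independent b → HasCard (Span b) (r ℕ.^ d)
  Span-card {zero}  b _     = HasCard-resp-⇔ (HasCard-｛｝ 0v) (λ { refl → (λ ()) , (λ ()) , refl }) (λ (_ , _ , eq) → sym eq)
  Span-card {suc d} b indep = HasCard-image (HasCard-⟨×⟩ F-card (Span-card (tail b) tail-indep)) record
    { injection  = record
      { maps-to   = λ { {c₀ , v} (c₀∈F , c , c∈F , v≡) → (c₀ ∷ c) , ∷-InF c₀∈F c∈F , cong ((c₀ · b zero) +v_) v≡ }
      ; injective = injective
      }
    ; surjective = λ (c , c∈F , v≡) → (c zero , linComb (tail c) (tail b)) ,
                                       (c∈F zero , tail c , (λ i → c∈F (suc i)) , refl) , sym v≡
    }
    where
    tail-indep : Independent (tail b)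
    tail-indep c c′ c∈F c′∈F eq i =
      indep (0# ∷ c) (0# ∷ c′) (∷-InF 0∈ c∈F) (∷-InF 0∈ c′∈F) (cong ((0# · b zero) +v_) eq) (suc i)
    injective : ∀ {x y} → (F ⟨×⟩ Span (tail b)) x → (F ⟨×⟩ Span (tail b)) y →
                (proj₁ x · b zero) +v proj₂ x ≡ (proj₁ y · b zero) +v proj₂ y → x ≡ y
    injective {c₀ , v} {c₀′ , v′} (c₀∈F , c , c∈F , v≡) (c₀′∈F , c′ , c′∈F , v′≡) eq =
      cong₂ _,_ (same zero) (trans v≡ (trans (linComb-cong (tail b) (λ i → same (suc i))) (sym v′≡)))
      where
      same = indep (c₀ ∷ c) (c₀′ ∷ c′) (∷-InF c₀∈F c∈F) (∷-InF c₀′∈F c′∈F)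
               (trans (cong ((c₀ · b zero) +v_) (sym v≡)) (trans eq (cong ((c₀′ · b zero) +v_) v′≡)))

  HasDim⇒card : ∀ {W d} → HasDim F W d → HasCard W (r ℕ.^ d)
  HasDim⇒card {W} W-dim = HasCard-resp-⇔ (Span-card D.basis D.indep)
    (λ (c , c∈F , v≡) → subst W (sym v≡) (D.closed c c∈F)) (λ {u} u∈W → D.spans u u∈W)
    where module D = HasDim W-dim

  r^-injective : ∀ {a b} → r ℕ.^ a ≡ r ℕ.^ b → a ≡ b
  r^-injective {a} {b} eq with ℕ.<-cmp a b
  ... | tri< a<b _ _ = ⊥-elim (ℕ.<⇒≢ (ℕ.^-monoʳ-< r 1<r a<b) eq)
  ... | tri≈ _ a≡b _ = a≡b
  ... | tri> _ _ a>b = ⊥-elim (ℕ.<⇒≢ (ℕ.^-monoʳ-< r 1<r a>b) (sym eq))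

  HasDim-unique : ∀ {W d d′} → HasDim F W d → HasDim F W d′ → d ≡ d′
  HasDim-unique W-dim W-dim′ = r^-injective (HasCard-unique (HasDim⇒card W-dim) (HasDim⇒card W-dim′))

  HasDim-resp-⇔ : ∀ {V W d} → V ⊆ W → W ⊆ V → HasDim F V d → HasDim F W d
  HasDim-resp-⇔ V⊆W W⊆V V-dim = record
    { basis = D.basis ; closed = λ c c∈F → V⊆W (D.closed c c∈F)
    ; spans = λ u u∈W → D.spans u (W⊆V u∈W) ; indep = D.indep }
    where module D = HasDim V-dim

  Span? : ∀ {d} (b : Fin d → V2) → Decidable (Span b)
  Span? {zero} b v with v ≟v 0v
  ... | yes v≡0 = yes ((λ ()) , (λ ()) , v≡0)
  ... | no  v≢0 = no (λ (_ , _ , v≡0) → v≢0 v≡0)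
  Span? {suc d} b v with ∃? (λ c₀ → HasCard⇒decidable F-card _≟_ c₀ ×-dec Span? (tail b) (v -v (c₀ · b zero)))
  ... | yes (c₀ , c₀∈F , c , c∈F , v-c₀b₀≡) =
    yes ((c₀ ∷ c) , ∷-InF c₀∈F c∈F , trans (sym (u+[v-u]≡v (c₀ · b zero) v)) (cong ((c₀ · b zero) +v_) v-c₀b₀≡))
  ... | no  ∄c₀ = no (λ (c , c∈F , v≡) → ∄c₀ (c zero , c∈F zero , tail c , (λ i → c∈F (suc i)) ,
                        trans (cong (_-v (c zero · b zero)) v≡) ([u+v]-u≡v _ _)))

  independent-∷ : ∀ {k} {b : Fin k → V2} {w} → Independent₀ b → ¬ Span b w → Independent₀ (w ∷ b)
  independent-∷ {b = b} {w} indep w∉Span c c∈F eq with c zero ≟ 0#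
  ... | yes c₀≡0 = λ { zero → c₀≡0 ; (suc i) → indep (tail c) (λ i → c∈F (suc i)) tail≡0 i }
    where
    tail≡0 : linComb (tail c) b ≡ 0v
    tail≡0 = trans (sym (+v-identityˡ _)) (trans (cong (_+v linComb (tail c) b) (sym (trans (cong (_· w) c₀≡0) (0·u≡0 w)))) eq)
  ... | no  c₀≢0 = ⊥-elim (w∉Span (coeffs , (λ i → *-closed a∈F (c∈F (suc i))) , w≡))
    where
    c₀ = c zero
    a = c₀ ⁻¹ * - 1#
    a∈F : F a
    a∈F = *-closed (⁻¹-closed (c∈F zero)) (-‿closed 1∈)
    coeffs = λ i → a * c (suc i)
    w≡ : w ≡ linComb coeffs b
    w≡ = begin
      w                                       ≡⟨ 1·u≡u w ⟨
      1# · w                                  ≡⟨ cong (_· w) (x⁻¹*x≡1 c₀≢0) ⟨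
      (c₀ ⁻¹ * c₀) · w                        ≡⟨ ·-assoc _ _ w ⟨
      (c₀ ⁻¹) · (c₀ · w)                      ≡⟨ cong ((c₀ ⁻¹) ·_) (u+v≡0⇒u≡-v _ _ eq) ⟩
      (c₀ ⁻¹) · ((- 1#) · linComb (tail c) b) ≡⟨ ·-assoc _ _ _ ⟩
      a · linComb (tail c) b                  ≡⟨ linComb-· a (tail c) b ⟩
      linComb coeffs b                        ∎

  module _ {W : Pred V2 0ℓ} (W-subspace : IsSubspace W) {d : ℕ} (W-card : HasCard W (r ℕ.^ d)) where
    open IsSubspace W-subspace
    private module W = HasCard W-card

    outside-Span : ∀ {k} (b : Fin k → V2) → Independent b → k ℕ.< d → ∃[ w ] (W w × ¬ Span b w)
    outside-Span b indep k<d with Fin.any? (λ i → ¬? (Span? b (W.enum i)))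
    ... | yes (i , ∉Span) = W.enum i , W.enum-P i , ∉Span
    ... | no  ∄i          = ⊥-elim (ℕ.<⇒≱ (ℕ.^-monoʳ-< r 1<r k<d) (HasCard-⊆⇒≤ W-card (Span-card b indep) W⊆Span))
      where
      W⊆Span : W ⊆ Span b
      W⊆Span {w} w∈W = decidable-stable (Span? b w)
        (λ w∉Span → ∄i (index W-card w∈W , λ ∈Span → w∉Span (subst (Span b) (enum-index W-card w∈W) ∈Span)))

    spanning⇒HasDim : ∀ {k} (b : Fin k → V2) → (∀ i → W (b i)) → Independent₀ b → W ⊆ Span b → HasDim F W k
    spanning⇒HasDim b b∈W indep W⊆Span = record
      { basis = b ; closed = linComb∈ b b∈W ; spans = λ _ u∈W → W⊆Span u∈W
      ; indep = independent₀⇒independent indep }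

    extend-to-basis : ∀ s {k} (b : Fin k → V2) → s ℕ.+ k ≡ d → (∀ i → W (b i)) → Independent₀ b → HasDim F W d
    extend-to-basis zero    b k≡d b∈W indep = subst (HasDim F W) k≡d (spanning⇒HasDim b b∈W indep
      (HasCard-⊆⇒⊇ W-card _≟v_ (Span? b)
        (subst (HasCard (Span b)) (cong (r ℕ.^_) k≡d) (Span-card b (independent₀⇒independent indep))) (Span⊆ b∈W)))
    extend-to-basis (suc s) {k} b 1+s+k≡d b∈W indep =
      let w , w∈W , w∉Span = outside-Span b (independent₀⇒independent indep) k<d in
      extend-to-basis s (w ∷ b) (trans (ℕ.+-suc s k) 1+s+k≡d) (∷-∈W w∈W) (independent-∷ indep w∉Span)
      where
      k<d : k ℕ.< d
      k<d = subst (k ℕ.<_) 1+s+k≡d (s≤s (ℕ.m≤n+m k s))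
      ∷-∈W : ∀ {w} → W w → ∀ i → W ((w ∷ b) i)
      ∷-∈W w∈W zero    = w∈W
      ∷-∈W w∈W (suc i) = b∈W i

    card⇒HasDim : HasDim F W d
    card⇒HasDim = extend-to-basis d (λ ()) (ℕ.+-identityʳ d) (λ ()) (λ _ _ _ ())

  module _ {V W : Pred V2 0ℓ} {φ : V2 → V2} (φ-bijection : BijectionOn V W φ) {d : ℕ} where

    HasDim-image : IsSubspace W → HasDim F V d → HasDim F W d
    HasDim-image W-subspace V-dim = card⇒HasDim W-subspace (HasCard-image (HasDim⇒card V-dim) φ-bijection)

    HasDim-preimage : IsSubspace V → HasDim F W d → HasDim F V d
    HasDim-preimage V-subspace W-dim = card⇒HasDim V-subspace (HasCard-preimage (HasDim⇒card W-dim) φ-bijection)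

-- The linear set L = L_{F_{q^t} × S_{f,ξ}}

module LinearSet (K : Field) {q t : ℕ} (q-primePower : IsPrimePower q) (t≥1 : t ≥ 1)
                    (finite : HasCard (FieldDefs.All K) (q ℕ.^ (2 ℕ.* t)))
                    (ξ : FieldDefs.Carrier K) (ξ∉Fqt : ¬ FieldDefs.Sub K q t ξ)
                    (c : Fin t → FieldDefs.Carrier K) (c∈Fqt : ∀ i → FieldDefs.Sub K q t (c i)) where
  open FieldDefs K
  open FieldProperties K
  open VectorProperties K
  open FiniteField K finite
  open GaloisField K {n = 2 ℕ.* t} q-primePower finite
  open ≡-Reasoning

  Fq Fqt : Pred Carrier 0ℓ
  Fq  = Sub q 1
  Fqt = Sub q t

  module Fqt = IsSubfield (Sub-isSubfield t)

  Fq-card : HasCard Fq q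
  Fq-card = subst (HasCard Fq) (ℕ.*-identityʳ q)
    (SubfieldCard.Sub-card {1} (ℕ.*-identityˡ (2 ℕ.* t)) (s≤s z≤n) (ℕ.≤-trans t≥1 (ℕ.m≤m+n t (t ℕ.+ 0))))

  Fqt-card : HasCard Fqt (q ℕ.^ t)
  Fqt-card = SubfieldCard.Sub-card (ℕ.*-comm t 2) t≥1 (s≤s z≤n)

  open LinearAlgebra K finite (Sub-isSubfield 1) Fq-card public

  f : Carrier → Carrier
  f = linPoly q t c

  f-+ : ∀ x y → f (x + y) ≡ f x + f y
  f-+ x y = trans (sumFin-cong t (λ i → trans (cong (c i *_) (frobenius-q^ (toℕ i) x y)) (distribˡ (c i) _ _)))
                  (sumFin-+ t _ _)

  f-· : ∀ {a} → Fq a → ∀ x → f (a * x) ≡ a * f x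
  f-· {a} a∈Fq x = trans (sumFin-cong t λ i → begin
      c i * (a * x) ^ (q ℕ.^ toℕ i)              ≡⟨ cong (c i *_) (^-distribʳ-* a x (q ℕ.^ toℕ i)) ⟩
      c i * (a ^ (q ℕ.^ toℕ i) * x ^ (q ℕ.^ toℕ i)) ≡⟨ cong (λ z → c i * (z * x ^ (q ℕ.^ toℕ i))) (Sub-1⊆Sub (toℕ i) a∈Fq) ⟩
      c i * (a * x ^ (q ℕ.^ toℕ i))              ≡⟨ x∙yz≈y∙xz (c i) a _ ⟩
      a * (c i * x ^ (q ℕ.^ toℕ i))              ∎)
    (sumFin-* t a _)

  f-0 : f 0# ≡ 0#
  f-0 = +-cancelˡ (f 0#) (f 0#) 0# (begin
    f 0# + f 0#      ≡⟨ f-+ 0# 0# ⟨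
    f (0# + 0#)      ≡⟨ cong f (+-identityʳ 0#) ⟩
    f 0#             ≡⟨ +-identityʳ (f 0#) ⟨
    f 0# + 0#        ∎)

  f-Fqt : ∀ {x} → Fqt x → Fqt (f x)
  f-Fqt x∈Fqt = Fqt.sumFin-closed t (λ i → Fqt.*-closed (c∈Fqt i) (Fqt.^-closed x∈Fqt (q ℕ.^ toℕ i)))

  Fq⊆Fqt : Fq ⊆ Fqt
  Fq⊆Fqt = Sub-1⊆Sub t

  coords-unique : ∀ {a b a′ b′} → Fqt a → Fqt b → Fqt a′ → Fqt b′ →
                  a + b * ξ ≡ a′ + b′ * ξ → a ≡ a′ × b ≡ b′
  coords-unique {a} {b} {a′} {b′} a∈ b∈ a′∈ b′∈ eq with b ≟ b′
  ... | yes refl = +-cancelʳ (b * ξ) a a′ eq , refl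
  ... | no  b≢b′ = ⊥-elim (ξ∉Fqt (subst Fqt ξ≡
                     (Fqt.*-closed (Fqt.−-closed a′∈ a∈) (Fqt.⁻¹-closed (Fqt.−-closed b∈ b′∈)))))
    where
    b-b′≢0 : b - b′ ≢ 0#
    b-b′≢0 b-b′≡0 = b≢b′ (x∙y⁻¹≈ε⇒x≈y b b′ b-b′≡0)
    [b-b′]ξ≡a′-a : (b - b′) * ξ ≡ a′ - a
    [b-b′]ξ≡a′-a = +-cancelˡ a _ _ (begin
      a + (b - b′) * ξ          ≡⟨ cong (a +_) (distribʳ ξ b (- b′)) ⟩
      a + (b * ξ + - b′ * ξ)    ≡⟨ +-assoc a (b * ξ) _ ⟨
      a + b * ξ + - b′ * ξ      ≡⟨ cong₂ _+_ eq (sym (-‿distribˡ-* b′ ξ)) ⟩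
      a′ + b′ * ξ - b′ * ξ      ≡⟨ //-rightDividesʳ (b′ * ξ) a′ ⟩
      a′                        ≡⟨ //-rightDividesˡ a a′ ⟨
      a′ - a + a                ≡⟨ +-comm _ a ⟩
      a + (a′ - a)              ∎)
    ξ≡ : (a′ - a) * (b - b′) ⁻¹ ≡ ξ
    ξ≡ = trans (cong (_* (b - b′) ⁻¹) (sym [b-b′]ξ≡a′-a))
           (trans (cong (_* (b - b′) ⁻¹) (*-comm _ ξ)) ([y*x]*x⁻¹≡y b-b′≢0 ξ))

  Fqt? : Decidable Fqt
  Fqt? = HasCard⇒decidable Fqt-card _≟_

  IsCombination : Pred Carrier 0ℓ
  IsCombination m = ∃[ m₀ ] ∃[ m₁ ] ((Fqt m₀ × Fqt m₁) × m₀ + m₁ * ξ ≡ m)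

  q^t*q^t≡q^[2t] : q ℕ.^ t ℕ.* q ℕ.^ t ≡ q ℕ.^ (2 ℕ.* t)
  q^t*q^t≡q^[2t] = trans (sym (ℕ.^-distribˡ-+-* q t t)) (cong (λ s → q ℕ.^ (t ℕ.+ s)) (sym (ℕ.+-identityʳ t)))

  -- m₀ + m₁ ξ takes q ^ t · q ^ t = |K| distinct values, hence every value.
  decompose : ∀ m → IsCombination m
  decompose m = HasCard-⊆⇒⊇ finite _≟_ IsCombination? combinations-card (λ _ → tt) tt
    where
    IsCombination? : Decidable IsCombination
    IsCombination? m = ∃? (λ m₀ → ∃? (λ m₁ → (Fqt? m₀ ×-dec Fqt? m₁) ×-dec (m₀ + m₁ * ξ ≟ m)))
    combinations-card : HasCard IsCombination (q ℕ.^ (2 ℕ.* t))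
    combinations-card = subst (HasCard IsCombination) q^t*q^t≡q^[2t] (HasCard-image (HasCard-⟨×⟩ Fqt-card Fqt-card) record
      { injection  = record
        { maps-to   = λ {(a , b)} a,b∈ → a , b , a,b∈ , refl
        ; injective = λ (a∈ , b∈) (a′∈ , b′∈) eq →
                        let a≡a′ , b≡b′ = coords-unique a∈ b∈ a′∈ b′∈ eq in cong₂ _,_ a≡a′ b≡b′
        }
      ; surjective = λ (m₀ , m₁ , m₀,m₁∈ , eq) → (m₀ , m₁) , m₀,m₁∈ , eq
      })

  U Uᶠ : Pred V2 0ℓ
  U  = UL q t f ξ
  Uᶠ = Uf q t f

  0∈S : Sfξ q t f ξ 0#
  0∈S = 0# , Fqt.0∈ , sym (begin
    0# + ξ * f 0#   ≡⟨ cong (λ z → 0# + ξ * z) f-0 ⟩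
    0# + ξ * 0#     ≡⟨ +-identityˡ _ ⟩
    ξ * 0#          ≡⟨ zeroʳ ξ ⟩
    0#              ∎)

  S-injective : ∀ {u u′} → Fqt u → Fqt u′ → u + ξ * f u ≡ u′ + ξ * f u′ → u ≡ u′
  S-injective {u} {u′} u∈ u′∈ eq = proj₁ (coords-unique u∈ (f-Fqt u∈) u′∈ (f-Fqt u′∈)
    (trans (cong (u +_) (*-comm (f u) ξ)) (trans eq (cong (u′ +_) (*-comm ξ (f u′))))))

  U-isSubspace : IsSubspace U
  U-isSubspace = record
    { 0v∈       = Fqt.0∈ , 0∈S
    ; +v-closed = λ { (a∈ , u , u∈ , refl) (a′∈ , u′ , u′∈ , refl) →
                      Fqt.+-closed a∈ a′∈ , u + u′ , Fqt.+-closed u∈ u′∈ , S-+ u u′ }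
    ; ·-closed  = λ { {k} k∈ (a∈ , u , u∈ , refl) →
                      Fqt.*-closed (Fq⊆Fqt k∈) a∈ , k * u , Fqt.*-closed (Fq⊆Fqt k∈) u∈ , S-· k∈ u }
    }
    where
    S-+ : ∀ u u′ → (u + ξ * f u) + (u′ + ξ * f u′) ≡ (u + u′) + ξ * f (u + u′)
    S-+ u u′ = begin
      (u + ξ * f u) + (u′ + ξ * f u′)  ≡⟨ +-interchange _ _ _ _ ⟩
      (u + u′) + (ξ * f u + ξ * f u′)  ≡⟨ cong ((u + u′) +_) (distribˡ ξ _ _) ⟨
      (u + u′) + ξ * (f u + f u′)      ≡⟨ cong (λ z → (u + u′) + ξ * z) (f-+ u u′) ⟨
      (u + u′) + ξ * f (u + u′)        ∎
    S-· : ∀ {k} → Fq k → ∀ u → k * (u + ξ * f u) ≡ k * u + ξ * f (k * u)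
    S-· {k} k∈ u = begin
      k * (u + ξ * f u)          ≡⟨ distribˡ k u _ ⟩
      k * u + k * (ξ * f u)      ≡⟨ cong (k * u +_) (x∙yz≈y∙xz k ξ _) ⟩
      k * u + ξ * (k * f u)      ≡⟨ cong (λ z → k * u + ξ * z) (f-· k∈ u) ⟨
      k * u + ξ * f (k * u)      ∎

  Uᶠ-isSubspace : IsSubspace Uᶠ
  Uᶠ-isSubspace = record
    { 0v∈       = 0# , Fqt.0∈ , cong (0# ,_) (sym f-0)
    ; +v-closed = λ { (x , x∈ , refl) (x′ , x′∈ , refl) →
                      x + x′ , Fqt.+-closed x∈ x′∈ , cong (x + x′ ,_) (sym (f-+ x x′)) }
    ; ·-closed  = λ { {k} k∈ (x , x∈ , refl) → k * x , Fqt.*-closed (Fq⊆Fqt k∈) x∈ , cong (k * x ,_) (sym (f-· k∈ x)) }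
    }

  All-isSubfield : IsSubfield All
  All-isSubfield = record
    { 0∈ = tt ; 1∈ = tt ; +-closed = λ _ _ → tt ; -‿closed = λ _ → tt ; *-closed = λ _ _ → tt ; ⁻¹-closed = λ _ → tt }

  U∩⟨_⟩ : V2 → Pred V2 0ℓ
  U∩⟨ v ⟩ = U ∩ span All v

  U∩⟨_⟩-isSubspace : ∀ v → IsSubspace U∩⟨ v ⟩
  U∩⟨ v ⟩-isSubspace = ∩-isSubspace U-isSubspace (span-isSubspace All-isSubfield (λ _ → tt) v)

  Uᶠ∩⟨_⟩ : V2 → Pred V2 0ℓ
  Uᶠ∩⟨ v ⟩ = Uᶠ ∩ span Fqt v

  Uᶠ∩⟨_⟩-isSubspace : ∀ v → IsSubspace Uᶠ∩⟨ v ⟩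
  Uᶠ∩⟨ v ⟩-isSubspace = ∩-isSubspace Uᶠ-isSubspace (span-isSubspace (Sub-isSubfield t) Fq⊆Fqt v)

  rank : HasDim Fq U (2 ℕ.* t)
  rank = card⇒HasDim U-isSubspace (subst (HasCard U) q^t*q^t≡q^[2t] (HasCard-image (HasCard-⟨×⟩ Fqt-card Fqt-card) record
    { injection  = record
      { maps-to   = λ {(a , u)} (a∈ , u∈) → a∈ , u , u∈ , refl
      ; injective = λ (_ , u∈) (_ , u′∈) eq → cong₂ _,_ (cong proj₁ eq) (S-injective u∈ u′∈ (cong proj₂ eq))
      }
    ; surjective = λ { {a , s} (a∈ , u , u∈ , s≡) → (a , u) , (a∈ , u∈) , cong (a ,_) (sym s≡) }
    }))

  weight-⟨1,0⟩ : Weight Fq All U (1# , 0#) t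
  weight-⟨1,0⟩ = card⇒HasDim U∩⟨ 1# , 0# ⟩-isSubspace (HasCard-image Fqt-card record
    { injection  = record
      { maps-to   = λ {a} a∈ → (a∈ , 0∈S) , a , tt , cong₂ _,_ (sym (*-identityʳ a)) (sym (zeroʳ a))
      ; injective = λ _ _ → cong proj₁
      }
    ; surjective = λ { {a , s} ((a∈ , _) , k , _ , a,s≡) → a , a∈ , cong (a ,_) (sym (trans (cong proj₂ a,s≡) (zeroʳ k))) }
    })

  weight-⟨0,1⟩ : Weight Fq All U (0# , 1#) t
  weight-⟨0,1⟩ = card⇒HasDim U∩⟨ 0# , 1# ⟩-isSubspace (HasCard-image Fqt-card record
    { injection  = record
      { maps-to   = λ {u} u∈ → (Fqt.0∈ , u , u∈ , refl) , u + ξ * f u , tt , cong₂ _,_ (sym (zeroʳ _)) (sym (*-identityʳ _))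
      ; injective = λ u∈ u′∈ eq → S-injective u∈ u′∈ (cong proj₂ eq)
      }
    ; surjective = λ { {a , s} ((_ , u , u∈ , s≡) , k , _ , a,s≡) →
                       u , u∈ , cong₂ _,_ (sym (trans (cong proj₁ a,s≡) (zeroʳ k))) (sym s≡) }
    })

  module _ {m₀ m₁ : Carrier} (m₀∈ : Fqt m₀) (m₁∈ : Fqt m₁) (m≢0 : m₀ + m₁ * ξ ≢ 0#) where
    private
      m = m₀ + m₁ * ξ

      φ : V2 → V2
      φ (a , _) = m₀ * a , m₁ * a

      a*m≡ : ∀ a → a * m ≡ m₀ * a + (m₁ * a) * ξ
      a*m≡ a = begin
        a * (m₀ + m₁ * ξ)          ≡⟨ distribˡ a m₀ _ ⟩
        a * m₀ + a * (m₁ * ξ)      ≡⟨ cong₂ _+_ (*-comm a m₀) (sym (*-assoc a m₁ ξ)) ⟩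
        m₀ * a + (a * m₁) * ξ      ≡⟨ cong (λ z → m₀ * a + z * ξ) (*-comm a m₁) ⟩
        m₀ * a + (m₁ * a) * ξ      ∎

      on-line : ∀ {a b} → U∩⟨ 1# , m ⟩ (a , b) → b ≡ a * m
      on-line (_ , k , _ , a,b≡) = trans (cong proj₂ a,b≡) (cong (_* m) (sym (trans (cong proj₁ a,b≡) (*-identityʳ k))))

      φ-bijection : BijectionOn U∩⟨ 1# , m ⟩ Uᶠ∩⟨ m₀ , m₁ ⟩ φ
      φ-bijection = record
        { injection  = record { maps-to = maps-to ; injective = injective }
        ; surjective = surjective
        }
        where
        maps-to : ∀ {x} → U∩⟨ 1# , m ⟩ x → Uᶠ∩⟨ m₀ , m₁ ⟩ (φ x)
        maps-to {a , b} x∈@((a∈ , u , u∈ , b≡) , _) =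
          let u≡ , fu≡ = coords-unique u∈ (f-Fqt u∈) (Fqt.*-closed m₀∈ a∈) (Fqt.*-closed m₁∈ a∈) (begin
                u + f u * ξ    ≡⟨ cong (u +_) (*-comm (f u) ξ) ⟩
                u + ξ * f u    ≡⟨ b≡ ⟨
                b              ≡⟨ on-line x∈ ⟩
                a * m          ≡⟨ a*m≡ a ⟩
                m₀ * a + (m₁ * a) * ξ ∎)
          in (u , u∈ , sym (cong₂ _,_ u≡ fu≡)) , a , a∈ , cong₂ _,_ (*-comm m₀ a) (*-comm m₁ a)
        injective : ∀ {x y} → U∩⟨ 1# , m ⟩ x → U∩⟨ 1# , m ⟩ y → φ x ≡ φ y → x ≡ y
        injective {a , b} {a′ , b′} x∈ y∈ φx≡φy =
          cong₂ _,_ a≡a′ (trans (on-line x∈) (trans (cong (_* m) a≡a′) (sym (on-line y∈))))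
          where
          a≡a′ : a ≡ a′
          a≡a′ with m₀ ≟ 0# | m₁ ≟ 0#
          ... | no  m₀≢0 | _        = *-cancelˡ m₀≢0 (cong proj₁ φx≡φy)
          ... | yes _    | no  m₁≢0 = *-cancelˡ m₁≢0 (cong proj₂ φx≡φy)
          ... | yes refl | yes refl = ⊥-elim (m≢0 (trans (+-identityˡ _) (zeroˡ ξ)))
        surjective : ∀ {y} → Uᶠ∩⟨ m₀ , m₁ ⟩ y → ∃[ x ] (U∩⟨ 1# , m ⟩ x × φ x ≡ y)
        surjective {x , y} ((x′ , x′∈ , x,y≡) , k , k∈ , x,y≡k·m) =
          (k , k * m) , ((k∈ , x′ , x′∈ , km≡) , k , tt , cong (_, k * m) (sym (*-identityʳ k))) ,
          cong₂ _,_ (trans (*-comm m₀ k) (sym (cong proj₁ x,y≡k·m))) (trans (*-comm m₁ k) (sym (cong proj₂ x,y≡k·m)))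
          where
          km≡ : k * m ≡ x′ + ξ * f x′
          km≡ = begin
            k * m                       ≡⟨ a*m≡ k ⟩
            m₀ * k + (m₁ * k) * ξ       ≡⟨ cong₂ (λ u v → u + v * ξ) (trans (*-comm m₀ k) (sym (cong proj₁ x,y≡k·m)))
                                                                     (trans (*-comm m₁ k) (sym (cong proj₂ x,y≡k·m))) ⟩
            x + y * ξ                   ≡⟨ cong₂ (λ u v → u + v * ξ) (cong proj₁ x,y≡) (cong proj₂ x,y≡) ⟩
            x′ + f x′ * ξ               ≡⟨ cong (x′ +_) (*-comm (f x′) ξ) ⟩
            x′ + ξ * f x′               ∎

    weight-⟨1,m⟩ : ∀ w → Weight Fq All U (1# , m) w ⇔ Weight Fq Fqt Uᶠ (m₀ , m₁) w
    weight-⟨1,m⟩ w = mk⇔ (HasDim-image φ-bijection (Uᶠ∩⟨ m₀ , m₁ ⟩-isSubspace))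
                         (HasDim-preimage φ-bijection (U∩⟨ 1# , m ⟩-isSubspace))

  weight-Uᶠ-⟨0,y⟩ : ∀ y {w} → w ≥ 1 → ¬ Weight Fq Fqt Uᶠ (0# , y) w
  weight-Uᶠ-⟨0,y⟩ y w≥1 weight = ℕ.<⇒≢ (ℕ.^-monoʳ-< q 1<q w≥1) (HasCard-unique trivial (HasDim⇒card weight))
    where
    trivial : HasCard Uᶠ∩⟨ 0# , y ⟩ 1
    trivial = HasCard-resp-⇔ (HasCard-｛｝ 0v)
      (λ { refl → Uᶠ-isSubspace .IsSubspace.0v∈ , 0# , Fqt.0∈ , sym (0·u≡0 _) })
      (λ { ((x , _ , refl) , k , _ , x,fx≡) → let x≡0 = trans (cong proj₁ x,fx≡) (zeroʳ k) in
             sym (cong₂ _,_ x≡0 (trans (cong f x≡0) f-0)) })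

  weight-Uᶠ-scale : ∀ {α} → Fqt α → α ≢ 0# → ∀ {μ w} →
                    Weight Fq Fqt Uᶠ (1# , μ) w ⇔ Weight Fq Fqt Uᶠ (α , α * μ) w
  weight-Uᶠ-scale {α} α∈ α≢0 {μ} = mk⇔ (HasDim-resp-⇔ scale unscale) (HasDim-resp-⇔ unscale scale)
    where
    α·⟨1,μ⟩ : α · (1# , μ) ≡ (α , α * μ)
    α·⟨1,μ⟩ = cong (_, α * μ) (*-identityʳ α)
    scale : Uᶠ∩⟨ 1# , μ ⟩ ⊆ Uᶠ∩⟨ α , α * μ ⟩
    scale (u∈ , s) = u∈ , subst (λ v → span Fqt v _) α·⟨1,μ⟩ (span-·⁺ (Sub-isSubfield t) α∈ α≢0 s)
    unscale : Uᶠ∩⟨ α , α * μ ⟩ ⊆ Uᶠ∩⟨ 1# , μ ⟩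
    unscale (u∈ , s) = u∈ , span-·⁻ (Sub-isSubfield t) α∈ (subst (λ v → span Fqt v _) (sym α·⟨1,μ⟩) s)

  module _ {w : ℕ} (w≥1 : w ≥ 1) where
    private
      PointOfL PointOfLᶠ Axes Affine : Pred (Maybe Carrier) 0ℓ
      PointOfL  P = IsPoint All P × Weight Fq All U (ptVec P) w
      PointOfLᶠ P = IsPoint Fqt P × Weight Fq Fqt Uᶠ (ptVec P) w
      Axes      P = (P ≡ nothing ⊎ P ≡ just 0#) × w ≡ t
      Affine    P = ∃[ m ] (P ≡ just m × m ≢ 0# × Weight Fq All U (1# , m) w)

      Slope : Pred Carrier 0ℓ
      Slope μ = Fqt μ × Weight Fq Fqt Uᶠ (1# , μ) w

      Slope-card : ∀ {b} → HasCard PointOfLᶠ b → HasCard Slope b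
      Slope-card card = HasCard-preimage card record
        { injection  = record { maps-to = λ μ∈ → μ∈ ; injective = λ _ _ → just-injective }
        ; surjective = λ { {nothing} (_ , weight) → ⊥-elim (weight-Uᶠ-⟨0,y⟩ 1# w≥1 weight)
                         ; {just μ}  μ∈          → μ , μ∈ , refl }
        }

      ScaledSlope : Pred (Carrier × Carrier) 0ℓ
      ScaledSlope = (Fqt ∖ ｛ 0# ｝) ⟨×⟩ Slope

      -- ⟨(1, α + αμ ξ)⟩ of L corresponds to ⟨(α, αμ)⟩ = ⟨(1, μ)⟩ of L_f.
      toAffine : Carrier × Carrier → Maybe Carrier
      toAffine (α , μ) = just (α + (α * μ) * ξ)

      toAffine-maps-to : ∀ {x} → ScaledSlope x → Affine (toAffine x)
      toAffine-maps-to {α , μ} ((α∈ , 0≢α) , μ∈ , weight) = _ , refl , m≢0 ,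
        Equivalence.from (weight-⟨1,m⟩ α∈ αμ∈ m≢0 w)
          (Equivalence.to (weight-Uᶠ-scale α∈ (λ α≡0 → 0≢α (sym α≡0))) weight)
        where
        αμ∈ = Fqt.*-closed α∈ μ∈
        m≢0 : α + (α * μ) * ξ ≢ 0#
        m≢0 m≡0 = 0≢α (sym (proj₁ (coords-unique α∈ αμ∈ Fqt.0∈ Fqt.0∈
          (trans m≡0 (sym (trans (+-identityˡ _) (zeroˡ ξ)))))))

      toAffine-injective : ∀ {x y} → ScaledSlope x → ScaledSlope y → toAffine x ≡ toAffine y → x ≡ y
      toAffine-injective {α , μ} {α′ , μ′} ((α∈ , 0≢α) , μ∈ , _) ((α′∈ , _) , μ′∈ , _) eq
        with coords-unique α∈ (Fqt.*-closed α∈ μ∈) α′∈ (Fqt.*-closed α′∈ μ′∈) (just-injective eq)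
      ... | refl , αμ≡αμ′ = cong (α ,_) (*-cancelˡ (λ α≡0 → 0≢α (sym α≡0)) αμ≡αμ′)

      toAffine-preimage : ∀ {m₀ m₁} → Fqt m₀ → Fqt m₁ → (m≢0 : m₀ + m₁ * ξ ≢ 0#) →
                          Weight Fq All U (1# , m₀ + m₁ * ξ) w →
                          ∃[ x ] (ScaledSlope x × toAffine x ≡ just (m₀ + m₁ * ξ))
      toAffine-preimage {m₀} {m₁} m₀∈ m₁∈ m≢0 weight = by-cases (m₀ ≟ 0#)
        where
        weightᶠ : Weight Fq Fqt Uᶠ (m₀ , m₁) w
        weightᶠ = Equivalence.to (weight-⟨1,m⟩ m₀∈ m₁∈ m≢0 w) weight
        by-cases : Dec (m₀ ≡ 0#) → ∃[ x ] (ScaledSlope x × toAffine x ≡ just (m₀ + m₁ * ξ))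
        by-cases (yes m₀≡0) =
          ⊥-elim (weight-Uᶠ-⟨0,y⟩ m₁ w≥1 (subst (λ z → Weight Fq Fqt Uᶠ (z , m₁) w) m₀≡0 weightᶠ))
        by-cases (no  m₀≢0) =
          (m₀ , μ) , ((m₀∈ , λ 0≡m₀ → m₀≢0 (sym 0≡m₀)) , Fqt.*-closed m₁∈ (Fqt.⁻¹-closed m₀∈) , μ-weight) ,
          cong (λ z → just (m₀ + z * ξ)) m₀μ≡m₁
          where
          μ = m₁ * m₀ ⁻¹
          m₀μ≡m₁ : m₀ * μ ≡ m₁
          m₀μ≡m₁ = trans (*-comm m₀ μ) ([y*x⁻¹]*x≡y m₀≢0 m₁)
          μ-weight : Weight Fq Fqt Uᶠ (1# , μ) w
          μ-weight = Equivalence.from (weight-Uᶠ-scale m₀∈ m₀≢0)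
            (subst (λ z → Weight Fq Fqt Uᶠ (m₀ , z) w) (sym m₀μ≡m₁) weightᶠ)

      toAffine-surjective : ∀ {P} → Affine P → ∃[ x ] (ScaledSlope x × toAffine x ≡ P)
      toAffine-surjective (m , refl , m≢0 , weight) =
        let m₀ , m₁ , (m₀∈ , m₁∈) , m≡ = decompose m
            x , x∈ , toAffine[x]≡ = toAffine-preimage m₀∈ m₁∈ (λ m≡0 → m≢0 (trans (sym m≡) m≡0))
                                      (subst (λ z → Weight Fq All U (1# , z) w) (sym m≡) weight)
        in x , x∈ , trans toAffine[x]≡ (cong just m≡)

      Affine-card : ∀ {b} → HasCard Slope b → HasCard Affine ((q ℕ.^ t ∸ 1) ℕ.* b)
      Affine-card card = HasCard-image (HasCard-⟨×⟩ (HasCard-remove Fqt-card _≟_ Fqt.0∈) card) record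
        { injection  = record { maps-to = toAffine-maps-to ; injective = toAffine-injective }
        ; surjective = toAffine-surjective
        }

      Axes-card : HasCard Axes (if w ≡ᵇ t then 2 else 0)
      Axes-card with w ≡ᵇ t in w≡ᵇt
      ... | true  = HasCard-resp-⇔ (HasCard-∪ (HasCard-｛｝ nothing) (HasCard-｛｝ (just 0#)) λ { refl () })
                      (λ { (inj₁ refl) → inj₁ refl , w≡t ; (inj₂ refl) → inj₂ refl , w≡t })
                      (λ { (inj₁ refl , _) → inj₁ refl ; (inj₂ refl , _) → inj₂ refl })
        where
        w≡t : w ≡ t
        w≡t = ℕ.≡ᵇ⇒≡ w t (subst T (sym w≡ᵇt) tt)
      ... | false = HasCard-resp-⇔ HasCard-∅ (λ ()) (λ (_ , w≡t) → subst T w≡ᵇt (ℕ.≡⇒≡ᵇ w t w≡t))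

      PointOfL⊆ : PointOfL ⊆ Axes ∪ Affine
      PointOfL⊆ {nothing} (_ , weight) = inj₁ (inj₁ refl , HasDim-unique weight weight-⟨0,1⟩)
      PointOfL⊆ {just m}  (_ , weight) with m ≟ 0#
      ... | yes refl = inj₁ (inj₂ refl , HasDim-unique weight weight-⟨1,0⟩)
      ... | no  m≢0  = inj₂ (m , refl , m≢0 , weight)

      ⊆PointOfL : Axes ∪ Affine ⊆ PointOfL
      ⊆PointOfL (inj₁ (inj₁ refl , w≡t)) = tt , subst (Weight Fq All U (0# , 1#)) (sym w≡t) weight-⟨0,1⟩
      ⊆PointOfL (inj₁ (inj₂ refl , w≡t)) = tt , subst (Weight Fq All U (1# , 0#)) (sym w≡t) weight-⟨1,0⟩
      ⊆PointOfL (inj₂ (m , refl , _ , weight)) = tt , weight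

      Axes∩Affine≡∅ : ∀ {P} → Axes P → Affine P → ⊥
      Axes∩Affine≡∅ (inj₁ () , _)   (_ , refl , _)
      Axes∩Affine≡∅ (inj₂ refl , _) (_ , refl , m≢0 , _) = m≢0 refl

    weight-distribution : ∀ {a b} → HasCard PointOfL a → HasCard PointOfLᶠ b →
                          a ≡ (if w ≡ᵇ t then 2 else 0) ℕ.+ (q ℕ.^ t ∸ 1) ℕ.* b
    weight-distribution L-card Lᶠ-card = HasCard-unique L-card
      (HasCard-resp-⇔ (HasCard-∪ Axes-card (Affine-card (Slope-card Lᶠ-card)) Axes∩Affine≡∅) ⊆PointOfL PointOfL⊆)

theorem5p1 : (q t : ℕ) → IsPrimePower q → t ≥ 1 →
    (K : Field) → let open FieldDefs K in
    HasCard All (q ℕ.^ (2 ℕ.* t)) →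
    (ξ : Carrier) → ¬ Sub q t ξ →
    (c : Fin t → Carrier) → (∀ i → Sub q t (c i)) →
    let f = linPoly q t c
        n = 2 ℕ.* t
        U = UL q t f ξ
        Fq = Sub q 1
        Fqt = Sub q t
    in ¬ InL Fqt (Uf q t f) (1# , 0#) →
       HasDim Fq U n
     × (Weight Fq All U (1# , 0#) t × Weight Fq All U (0# , 1#) t)
     × (∀ m₀ m₁ → Fqt m₀ → Fqt m₁ → m₀ + m₁ * ξ ≢ 0# → ∀ w →
          Weight Fq All U (1# , m₀ + m₁ * ξ) w ⇔ Weight Fq Fqt (Uf q t f) (m₀ , m₁) w)
     × (∀ w → w ≥ 1 → ∀ a b →
          HasCard (λ P → IsPoint All P × Weight Fq All U (ptVec P) w) a →
          HasCard (λ P → IsPoint Fqt P × Weight Fq Fqt (Uf q t f) (ptVec P) w) b →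
          a ≡ (if w ≡ᵇ t then 2 else 0) ℕ.+ (q ℕ.^ t ∸ 1) ℕ.* b)
theorem5p1 q t q-primePower t≥1 K finite ξ ξ∉Fqt c c∈Fqt _ =
    rank
  , (weight-⟨1,0⟩ , weight-⟨0,1⟩)
  , (λ m₀ m₁ m₀∈ m₁∈ m≢0 → weight-⟨1,m⟩ m₀∈ m₁∈ m≢0)
  , (λ w w≥1 a b → weight-distribution w≥1)
  where open LinearSet K q-primePower t≥1 finite ξ ξ∉Fqt c c∈Fqt
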